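{- For every integer $n\geq 2$, $$\left|\mathsf{APS}^B_n\right| = \sum_{k=0}^{\left\lfloor\frac{n-1}{2}\right\rfloor}\binom{n}{k} \binom{n-1-k}{\left\lfloor\frac{n-1}{2}\right\rfloor-k}.$$
   Context: For $n\in\mathbb{N}$, $[n]=\{1,\dots,n\}$ and $\pm[n]=[n]\cup -[n]$. The group $\mathfrak{S}_n^B$ of signed permutations consists of the bijections $w:\pm[n]\to\pm[n]$ with $w(-i)=-w(i)$ for all $i$; it is written in one-line notation $w(1)w(2)\cdots w(n)$. A pinnacle of $w$ is a value $w(i)$ with $2\le i\le n-1$ and $w(i-1)<w(i)>w(i+1)$; the pinnacle set of $w$ is the set of its pinnacles. $\mathsf{APS}^B_n$ denotes the set of all subsets $S\subseteq \pm[n]$ that occur as the pinnacle set of some $w\in\mathfrak{S}_n^B$. -}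

module Defs where

open import Data.Bool using (Bool; true; false; not)
open import Data.Nat using (ℕ; zero; suc; _<_; _∸_; _*_; ⌊_/2⌋)
open import Data.Nat.Combinatorics using (_C_)
open import Data.Fin using (Fin; toℕ; fromℕ<)
open import Data.Fin.Subset using (Subset)
open import Data.Vec using (lookup)
open import Data.Integer as ℤ using (ℤ; +_; -[1+_])
open import Data.List using (List; map; upTo)
open import Data.Nat.ListAction using (sum)
open import Data.Product using (Σ; ∃; _×_; _,_; proj₁)
open import Function.Bundles using (_↔_; Inverse; _⇔_)
open import Relation.Binary.PropositionalEquality using (_≡_)
open import Data.Nat.Properties using (<-trans; n<1+n)

-- ±[n], encoded as (sign, |x|-1): (false , i) stands for +(i+1), (true , i) for -(i+1).
PM : ℕ → Set
PM n = Bool × Fin n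

neg : ∀ {n} → PM n → PM n
neg (b , i) = (not b , i)

val : ∀ {n} → PM n → ℤ
val (false , i) = + suc (toℕ i)
val (true  , i) = -[1+ toℕ i ]

SignedPerm : ℕ → Set
SignedPerm n = Σ (PM n ↔ PM n) λ w → ∀ x → Inverse.to w (neg x) ≡ neg (Inverse.to w x)

-- one-line notation: entry at 0-based position i is w(i+1)
entry : ∀ {n} → SignedPerm n → Fin n → PM n
entry (w , _) i = Inverse.to w (false , i)

-- x is a pinnacle of w: x = w(j+2) (1-based) with w(j+1) < w(j+2) > w(j+3), j+3 ≤ n
IsPinnacle : ∀ {n} → SignedPerm n → PM n → Set
IsPinnacle {n} w x =
  ∃ λ (i : ℕ) → Σ (suc (suc i) < n) λ p →
    let c = fromℕ< {suc i} (<-trans (n<1+n (suc i)) p)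
        a = fromℕ< {i} (<-trans (n<1+n i) (<-trans (n<1+n (suc i)) p))
        b = fromℕ< p
    in (x ≡ entry w c) × (val (entry w a) ℤ.< val (entry w c)) × (val (entry w b) ℤ.< val (entry w c))

-- subsets of ±[n]: (P , N), P = positive elements (by |x|-1), N = negative elements
SubsetPM : ℕ → Set
SubsetPM n = Subset n × Subset n

_∈±_ : ∀ {n} → PM n → SubsetPM n → Set
(false , i) ∈± (P , N) = lookup P i ≡ true
(true  , i) ∈± (P , N) = lookup N i ≡ true

IsPinnacleSetOf : ∀ {n} → SignedPerm n → SubsetPM n → Set
IsPinnacleSetOf w S = ∀ x → (x ∈± S) ⇔ IsPinnacle w x

InAPSB : ∀ {n} → SubsetPM n → Set
InAPSB {n} S = ∃ λ (w : SignedPerm n) → IsPinnacleSetOf w S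

apsFormula : ℕ → ℕ
apsFormula n = sum (map (λ k → (n C k) * ((n ∸ 1 ∸ k) C (m ∸ k))) (upTo (suc m)))
  where m = ⌊ (n ∸ 1) /2⌋

-- A set S ⊆ ±[n] is a pinnacle set exactly when it never contains both j and
-- -j, has at most ⌊(n-1)/2⌋ elements, and for each negative pinnacle x at least
-- (number of pinnacles ≤ x) + 1 free absolute values, i.e. ones with neither
-- sign in S, have their negative below x.  Necessity: k pinnacles ≤ t in a word force at least
-- 2k + 1 entries ≤ t; take t = n and t = x.  Sufficiency: alternate the
-- increasing negatives of the free absolute values with the increasing
-- pinnacles.  Counting: deleting the absolute values of the k positive
-- pinnacles leaves an admissible set of negative pinnacles, which gives the
-- factor C(n, k), and by Pascal's rule at most m - k negative pinnacles can be
-- placed admissibly on n - k absolute values in C(n-1-k, m-k) ways.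

module Submission where

open import Defs
open import Data.Bool using (Bool; true; false; not; _∨_; _∧_; _xor_; if_then_else_)
open import Data.Bool.Properties using (not-involutive)
open import Data.Empty using (⊥; ⊥-elim)
open import Data.Fin as Fin using (Fin; zero; suc; toℕ; fromℕ<; punchOut)
open import Data.Fin.Properties using (any?; punchOut-injective; injective⇒≤; toℕ-fromℕ<; toℕ<n; toℕ-injective)
open import Data.Integer as ℤ using (ℤ; -[1+_]; +≤+; -≤+; -≤-; +<+; -<+; -<-)
import Data.Integer.Properties as ℤ
open import Data.List using (List; []; _∷_; _++_; map; length; concatMap; upTo; applyUpTo; allFin; tabulate)
open import Data.List.Membership.Propositional using (_∈_; find; lose)
open import Data.List.Membership.Propositional.Properties
  using (∈-++⁺ˡ; ∈-++⁺ʳ; ∈-++⁻; ∈-map⁺; ∈-map⁻; ∈-concatMap⁺; ∈-concatMap⁻; ∈-upTo⁺; ∈-upTo⁻; ∈-tabulate⁺; ∈-tabulate⁻)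
open import Data.List.Membership.Propositional.Properties.WithK using (unique∧set⇒bag)
open import Data.List.Properties
  using (length-++; length-map; length-tabulate; ++-identityʳ; ++-assoc; map-++; map-∘; map-tabulate)
open import Data.List.Relation.Binary.BagAndSetEquality using (∼bag⇒↭)
open import Data.List.Relation.Binary.Disjoint.Propositional using (Disjoint)
open import Data.List.Relation.Binary.Permutation.Propositional
  using (_↭_; ↭-refl; ↭-prep; ↭-trans; ↭-sym; ↭⇒↭ₛ; module PermutationReasoning)
open import Data.List.Relation.Binary.Permutation.Propositional.Properties as Perm using (shift; ++⁺ˡ; map⁺)
import Data.List.Relation.Binary.Permutation.Setoid.Properties as PermSetoid
open import Data.List.Relation.Unary.All as All using (All; []; _∷_)
import Data.List.Relation.Unary.All.Properties as All
open import Data.List.Relation.Unary.Any using (here; there)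
open import Data.List.Relation.Unary.Unique.Propositional using (Unique; []; _∷_)
import Data.List.Relation.Unary.Unique.Propositional.Properties as Unique
open import Data.Nat using (ℕ; zero; suc; _+_; _*_; _∸_; _≤_; _<_; _<ᵇ_; pred; ⌊_/2⌋; z≤n; s≤s)
open import Data.Nat.Combinatorics using (_C_; nCk+nC[k+1]≡[n+1]C[k+1]; nCk≡nC[n∸k])
open import Data.Nat.Combinatorics.Specification using (k>n⇒nCk≡0)
open import Data.Nat.ListAction using (sum)
open import Data.Nat.ListAction.Properties using (sum-++; sum-↭)
open import Data.Nat.Properties
open import Algebra.Properties.CommutativeMonoid.Sum +-0-commutativeMonoid
  using (sum-cong-≗; ∑-distrib-+; sum-replicate-zero) renaming (sum to ∑)
open import Data.Nat.Solver using (module +-*-Solver)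
open import Data.Product using (Σ; ∃; _×_; _,_; proj₁; proj₂)
open import Data.Sum using (_⊎_; inj₁; inj₂)
open import Data.Unit using (⊤; tt)
open import Data.Vec using (Vec; []; _∷_; lookup; zipWith)
open import Function.Bundles using (_↔_; _⇔_; Inverse; Injection; Equivalence; mk⇔; mk↔ₛ′)
open import Function.Construct.Composition using (_⇔-∘_)
open import Function.Construct.Symmetry using (↔-sym)
open import Function.Properties.Inverse using (↔⇒↣)
open import Relation.Binary.PropositionalEquality
  using (_≡_; _≢_; refl; sym; trans; cong; cong₂; subst; subst₂; module ≡-Reasoning)
open import Relation.Binary.PropositionalEquality.Properties using (setoid)
open import Relation.Nullary using (Dec; does; yes; no; ¬_; contradiction)
open import Relation.Nullary.Decidable using (dec-true; dec-false)
open import Relation.Nullary.Reflects using (ofʸ; ofⁿ)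

open +-*-Solver using (solve; _:+_; _:*_; _:=_; con)

true≢false : true ≢ false
true≢false ()

m∸n∸o≡m∸o∸n : ∀ m n o → m ∸ n ∸ o ≡ m ∸ o ∸ n
m∸n∸o≡m∸o∸n m n o = trans (∸-+-assoc m n o) (trans (cong (m ∸_) (+-comm n o)) (sym (∸-+-assoc m o n)))

m∸n≡1+m∸[1+n] : ∀ {m n} → n < m → m ∸ n ≡ suc (m ∸ suc n)
m∸n≡1+m∸[1+n] {suc m} {zero}  _         = refl
m∸n≡1+m∸[1+n] {suc m} {suc n} (s≤s n<m) = m∸n≡1+m∸[1+n] n<m

⌊n/2⌋+⌊n/2⌋≤n : ∀ n → ⌊ n /2⌋ + ⌊ n /2⌋ ≤ n
⌊n/2⌋+⌊n/2⌋≤n n = ≤-trans (+-monoʳ-≤ ⌊ n /2⌋ (⌊n/2⌋≤⌈n/2⌉ n)) (≤-reflexive (⌊n/2⌋+⌈n/2⌉≡n n))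

sumUpTo : (ℕ → ℕ) → ℕ → ℕ
sumUpTo f zero    = 0
sumUpTo f (suc k) = f 0 + sumUpTo (λ i → f (suc i)) k

sum-map-applyUpTo : ∀ (f g : ℕ → ℕ) k → sum (map f (applyUpTo g k)) ≡ sumUpTo (λ i → f (g i)) k
sum-map-applyUpTo f g zero    = refl
sum-map-applyUpTo f g (suc k) = cong (f (g 0) +_) (sum-map-applyUpTo f (λ i → g (suc i)) k)

sumUpTo-suc : ∀ f k → sumUpTo f (suc k) ≡ sumUpTo f k + f k
sumUpTo-suc f zero    = +-comm (f 0) 0
sumUpTo-suc f (suc k) = trans (cong (f 0 +_) (sumUpTo-suc (λ i → f (suc i)) k)) (sym (+-assoc (f 0) _ _))

sumUpTo-ones : ∀ k → sumUpTo (λ _ → 1) k ≡ k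
sumUpTo-ones zero    = refl
sumUpTo-ones (suc k) = cong suc (sumUpTo-ones k)

sumUpTo-cong : ∀ {f g} k → (∀ i → i < k → f i ≡ g i) → sumUpTo f k ≡ sumUpTo g k
sumUpTo-cong zero    _   = refl
sumUpTo-cong (suc k) f≡g = cong₂ _+_ (f≡g 0 (s≤s z≤n)) (sumUpTo-cong k (λ i i<k → f≡g (suc i) (s≤s i<k)))

sumUpTo-distrib-+ : ∀ f g k → sumUpTo (λ i → f i + g i) k ≡ sumUpTo f k + sumUpTo g k
sumUpTo-distrib-+ f g zero    = refl
sumUpTo-distrib-+ f g (suc k) = trans (cong (f 0 + g 0 +_) (sumUpTo-distrib-+ _ _ k))
  (solve 4 (λ a b c d → (a :+ b) :+ (c :+ d) := (a :+ c) :+ (b :+ d)) refl (f 0) (g 0) _ _)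

sumUpTo-distribˡ-* : ∀ c f k → sumUpTo (λ i → c * f i) k ≡ c * sumUpTo f k
sumUpTo-distribˡ-* c f zero    = sym (*-zeroʳ c)
sumUpTo-distribˡ-* c f (suc k) = trans (cong (c * f 0 +_) (sumUpTo-distribˡ-* c _ k)) (sym (*-distribˡ-+ c (f 0) _))

∈-concatMap-upTo⁻ : ∀ {A : Set} (G : ℕ → List A) k {v} → v ∈ concatMap G (upTo k) → ∃ λ i → i < k × v ∈ G i
∈-concatMap-upTo⁻ G k m with i , i∈ , m′ ← find (∈-concatMap⁻ G {xs = upTo k} m) = i , ∈-upTo⁻ i∈ , m′

∈-concatMap-upTo⁺ : ∀ {A : Set} (G : ℕ → List A) k {i v} → i < k → v ∈ G i → v ∈ concatMap G (upTo k)
∈-concatMap-upTo⁺ G k i<k m = ∈-concatMap⁺ G {xs = upTo k} (lose (∈-upTo⁺ i<k) m)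

length-concatMap-upTo : ∀ {A : Set} (G : ℕ → List A) k → length (concatMap G (upTo k)) ≡ sumUpTo (λ i → length (G i)) k
length-concatMap-upTo G k = go (λ i → i) k
  where
    go : ∀ g k → length (concatMap G (applyUpTo g k)) ≡ sumUpTo (λ i → length (G (g i))) k
    go g zero    = refl
    go g (suc k) = trans (length-++ (G (g 0))) (cong (length (G (g 0)) +_) (go (λ i → g (suc i)) k))

concatMap-unique : ∀ {A B : Set} (key : A → B) (G : B → List A) {ks} → Unique ks → (∀ k → Unique (G k)) →
  (∀ k {v} → v ∈ G k → key v ≡ k) → Unique (concatMap G ks)
concatMap-unique key G {[]}     []           _        _        = []
concatMap-unique key G {k ∷ ks} (k∉ks ∷ ks!) G-unique G-keyed =
  Unique.++⁺ (G-unique k) (concatMap-unique key G ks! G-unique G-keyed) disjoint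
  where
    disjoint : ∀ {v} → v ∈ G k × v ∈ concatMap G ks → ⊥
    disjoint (m , m′) with k′ , k′∈ , m″ ← find (∈-concatMap⁻ G {xs = ks} m′) =
      All.lookup k∉ks k′∈ (trans (sym (G-keyed k m)) (G-keyed k′ m″))

Unique-resp-↭ : ∀ {A : Set} {xs ys : List A} → xs ↭ ys → Unique xs → Unique ys
Unique-resp-↭ xs↭ys = PermSetoid.Unique-resp-↭ (setoid _) (↭⇒↭ₛ xs↭ys)

-- Admissible sets

fromBool : Bool → ℕ
fromBool true  = 1
fromBool false = 0

trues : ∀ {n} → Vec Bool n → ℕ
trues []      = 0
trues (b ∷ v) = fromBool b + trues v

isFree : Bool → Bool → Bool
isFree p q = not (p ∨ q)

frees : ∀ {n} → Vec Bool n → Vec Bool n → ℕ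
frees P N = trues (zipWith isFree P N)

-- Entry i of P (resp. N) says whether +(i+1) (resp. -(i+1)) is a pinnacle, so
-- the tails describe the absolute values above i+1.  The q + 1 pinnacles up to
-- -(i+1) need q + 2 smaller non-pinnacle values, and these can only be the
-- negatives of the f free absolute values of the tail (neither sign a pinnacle).
AdmissibleAt : Bool → Bool → ℕ → ℕ → Set
AdmissibleAt p     false _ _ = ⊤
AdmissibleAt true  true  _ _ = ⊥
AdmissibleAt false true  q f = 2 + q ≤ f

Admissible : ∀ {n} → Vec Bool n → Vec Bool n → Set
Admissible []      []      = ⊤
Admissible (p ∷ P) (q ∷ N) = AdmissibleAt p q (trues N) (frees P N) × Admissible P N

maxPinnacles : ℕ → ℕ
maxPinnacles n = ⌊ (n ∸ 1) /2⌋

AdmissibleSet : ∀ {n} → SubsetPM n → Set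
AdmissibleSet {n} (P , N) = Admissible P N × trues P + trues N ≤ maxPinnacles n

trues+trues+frees≡n : ∀ {n} (P N : Vec Bool n) → Admissible P N → trues N + (trues P + frees P N) ≡ n
trues+trues+frees≡n []          []          _       = refl
trues+trues+frees≡n (true ∷ P)  (false ∷ N) (_ , a) =
  trans (+-suc (trues N) _) (cong suc (trues+trues+frees≡n P N a))
trues+trues+frees≡n (false ∷ P) (false ∷ N) (_ , a) =
  trans (cong (trues N +_) (+-suc (trues P) _)) (trans (+-suc (trues N) _) (cong suc (trues+trues+frees≡n P N a)))
trues+trues+frees≡n (false ∷ P) (true ∷ N)  (_ , a) = cong suc (trues+trues+frees≡n P N a)

frees≡n∸trues∸trues : ∀ {n} (P N : Vec Bool n) → Admissible P N → frees P N ≡ n ∸ trues N ∸ trues P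
frees≡n∸trues∸trues {n} P N a = sym (begin
    n ∸ trues N ∸ trues P                                      ≡⟨ cong (λ m → m ∸ trues N ∸ trues P) (sym (trues+trues+frees≡n P N a)) ⟩
    trues N + (trues P + frees P N) ∸ trues N ∸ trues P        ≡⟨ cong (_∸ trues P) (m+n∸m≡n (trues N) _) ⟩
    trues P + frees P N ∸ trues P                              ≡⟨ m+n∸m≡n (trues P) _ ⟩
    frees P N                                                  ∎)
  where open ≡-Reasoning

-- Enumerating and counting admissible sets

extend : ∀ {n} → Bool → Bool → SubsetPM n → SubsetPM (suc n)
extend p q (P , N) = (p ∷ P , q ∷ N)

enum : (n q k : ℕ) → List (SubsetPM n)
withPositive : (n q k : ℕ) → List (SubsetPM (suc n))
withNegative : (n q k : ℕ) → List (SubsetPM (suc n))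

enum zero    zero zero = ([] , []) ∷ []
enum zero    _    _    = []
enum (suc n) q    k    = map (extend false false) (enum n q k) ++ withPositive n q k ++ withNegative n q k

withPositive n q zero    = []
withPositive n q (suc k) = map (extend true false) (enum n q k)

withNegative n zero    k = []
withNegative n (suc q) k with 2 + q ≤? n ∸ q ∸ k
... | yes _ = map (extend false true) (enum n q k)
... | no  _ = []

enum-complete : ∀ {n} (P N : Vec Bool n) → Admissible P N → (P , N) ∈ enum n (trues N) (trues P)
enum-complete []          []          _ = here refl
enum-complete (false ∷ P) (false ∷ N) (_ , a) =
  ∈-++⁺ˡ (∈-map⁺ (extend false false) (enum-complete P N a))
enum-complete {suc n} (true ∷ P)  (false ∷ N) (_ , a) =
  ∈-++⁺ʳ (map (extend false false) (enum n (trues N) (suc (trues P)))) (∈-++⁺ˡ (∈-map⁺ (extend true false) (enum-complete P N a)))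
enum-complete {suc n} (false ∷ P) (true ∷ N) (h , a) with 2 + trues N ≤? n ∸ trues N ∸ trues P
... | yes _ = ∈-++⁺ʳ (map (extend false false) (enum n (suc (trues N)) (trues P)))
                (∈-++⁺ʳ (withPositive n (suc (trues N)) (trues P)) (∈-map⁺ (extend false true) (enum-complete P N a)))
... | no ¬h = contradiction (subst (2 + trues N ≤_) (frees≡n∸trues∸trues P N a) h) ¬h

enum-sound : ∀ n q k {S} → S ∈ enum n q k → Admissible (proj₁ S) (proj₂ S) × trues (proj₂ S) ≡ q × trues (proj₁ S) ≡ k
enum-sound zero    zero zero (here refl) = tt , refl , refl
enum-sound (suc n) q    k    m with ∈-++⁻ (map (extend false false) (enum n q k)) m
... | inj₁ m′ with ∈-map⁻ (extend false false) m′
...   | _ , m″ , refl with enum-sound n q k m″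
...     | a , eq , ek = (tt , a) , eq , ek
enum-sound (suc n) q k m | inj₂ m′ with ∈-++⁻ (withPositive n q k) m′
enum-sound (suc n) q (suc k) m | inj₂ _ | inj₁ m″ with ∈-map⁻ (extend true false) m″
... | _ , m‴ , refl with enum-sound n q k m‴
...   | a , eq , ek = (tt , a) , eq , cong suc ek
enum-sound (suc n) (suc q) k m | inj₂ _ | inj₂ m″ with 2 + q ≤? n ∸ q ∸ k
... | yes h with ∈-map⁻ (extend false true) m″
...   | (P , N) , m‴ , refl with enum-sound n q k m‴
...     | a , refl , refl = (subst (2 + trues N ≤_) (sym (frees≡n∸trues∸trues P N a)) h , a) , refl , refl

extend-injective : ∀ {n} p q {S T : SubsetPM n} → extend p q S ≡ extend p q T → S ≡ T
extend-injective p q {_ , _} {_ , _} refl = refl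

heads : ∀ {n} → SubsetPM (suc n) → Bool × Bool
heads (p ∷ _ , q ∷ _) = p , q

heads-extend : ∀ {n} p q {xs : List (SubsetPM n)} {S} → S ∈ map (extend p q) xs → heads S ≡ (p , q)
heads-extend p q m with ∈-map⁻ (extend p q) m
... | (_ , _) , _ , refl = refl

heads-withPositive : ∀ n q k {S} → S ∈ withPositive n q k → heads S ≡ (true , false)
heads-withPositive n q (suc k) = heads-extend true false

heads-withNegative : ∀ n q k {S} → S ∈ withNegative n q k → heads S ≡ (false , true)
heads-withNegative n (suc q) k m with 2 + q ≤? n ∸ q ∸ k
... | yes _ = heads-extend false true m

enum-unique : ∀ n q k → Unique (enum n q k)
withPositive-unique : ∀ n q k → Unique (withPositive n q k)
withNegative-unique : ∀ n q k → Unique (withNegative n q k)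

enum-unique zero    zero    zero    = [] ∷ []
enum-unique zero    zero    (suc k) = []
enum-unique zero    (suc q) k       = []
enum-unique (suc n) q       k       =
  Unique.++⁺ (Unique.map⁺ (extend-injective false false) (enum-unique n q k))
    (Unique.++⁺ (withPositive-unique n q k) (withNegative-unique n q k) positive-negative)
    neither-signed
  where
    positive-negative : Disjoint (withPositive n q k) (withNegative n q k)
    positive-negative (m , m′) with trans (sym (heads-withPositive n q k m)) (heads-withNegative n q k m′)
    ... | ()
    neither-signed : Disjoint (map (extend false false) (enum n q k)) (withPositive n q k ++ withNegative n q k)
    neither-signed (m , m′) with ∈-++⁻ (withPositive n q k) m′
    ... | inj₁ m″ with trans (sym (heads-extend false false m)) (heads-withPositive n q k m″)
    ...   | ()
    neither-signed (m , m′) | inj₂ m″ with trans (sym (heads-extend false false m)) (heads-withNegative n q k m″)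
    ...   | ()

withPositive-unique n q zero    = []
withPositive-unique n q (suc k) = Unique.map⁺ (extend-injective true false) (enum-unique n q k)

withNegative-unique n zero    k = []
withNegative-unique n (suc q) k with 2 + q ≤? n ∸ q ∸ k
... | yes _ = Unique.map⁺ (extend-injective false true) (enum-unique n q k)
... | no  _ = []

#enum : ℕ → ℕ → ℕ → ℕ
#enum n q k = length (enum n q k)

#withPositive : ℕ → ℕ → ℕ → ℕ
#withPositive n q zero    = 0
#withPositive n q (suc k) = #enum n q k

#withNegative : ℕ → ℕ → ℕ → ℕ
#withNegative n zero    k = 0
#withNegative n (suc q) k with 2 + q ≤? n ∸ q ∸ k
... | yes _ = #enum n q k
... | no  _ = 0

#enum-suc : ∀ n q k → #enum (suc n) q k ≡ #enum n q k + (#withPositive n q k + #withNegative n q k)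
#enum-suc n q k = trans (length-++ (map (extend false false) (enum n q k)))
  (cong₂ _+_ (length-map _ (enum n q k)) (trans (length-++ (withPositive n q k)) (cong₂ _+_ (positive q k) (negative q k))))
  where
    positive : ∀ q k → length (withPositive n q k) ≡ #withPositive n q k
    positive q zero    = refl
    positive q (suc k) = length-map _ (enum n q k)
    negative : ∀ q k → length (withNegative n q k) ≡ #withNegative n q k
    negative zero    k = refl
    negative (suc q) k with 2 + q ≤? n ∸ q ∸ k
    ... | yes _ = length-map _ (enum n q k)
    ... | no  _ = refl

#enum≡0 : ∀ n q k → n < k → #enum n q k ≡ 0
#withNegative≡0 : ∀ n q k → n < k → #withNegative n q k ≡ 0

#enum≡0 zero    zero    (suc k) _       = refl
#enum≡0 zero    (suc q) k       _       = refl
#enum≡0 (suc n) q       (suc k) (s≤s n<k) = begin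
    #enum (suc n) q (suc k)                                     ≡⟨ #enum-suc n q (suc k) ⟩
    #enum n q (suc k) + (#enum n q k + #withNegative n q (suc k)) ≡⟨ cong₂ _+_ (#enum≡0 n q (suc k) (m≤n⇒m≤1+n n<k))
                                                                    (cong₂ _+_ (#enum≡0 n q k n<k) (#withNegative≡0 n q (suc k) (m≤n⇒m≤1+n n<k))) ⟩
    0                                                           ∎
  where open ≡-Reasoning

#withNegative≡0 n zero    k _   = refl
#withNegative≡0 n (suc q) k n<k with 2 + q ≤? n ∸ q ∸ k
... | yes _ = #enum≡0 n q k n<k
... | no  _ = refl

-- The absolute values of positive pinnacles are neither free nor negative
-- pinnacles, so deleting them leaves every admissibility condition unchanged.
#enum≡C*#enum : ∀ n q k → k ≤ n → #enum n q k ≡ (n C k) * #enum (n ∸ k) q 0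
#enum≡C*#enum n q zero _ = sym (*-identityˡ (#enum n q 0))
#enum≡C*#enum (suc n) q (suc k) (s≤s k≤n) with m≤n⇒m<n∨m≡n k≤n
... | inj₂ refl = begin
    #enum (suc k) q (suc k)                                       ≡⟨ #enum-suc k q (suc k) ⟩
    #enum k q (suc k) + (#enum k q k + #withNegative k q (suc k))   ≡⟨ cong₂ _+_ (#enum≡0 k q (suc k) ≤-refl)
                                                                      (cong₂ _+_ (#enum≡C*#enum k q k ≤-refl) (#withNegative≡0 k q (suc k) ≤-refl)) ⟩
    (k C k) * X + 0                                               ≡⟨ +-identityʳ _ ⟩
    (k C k) * X                                                   ≡⟨ cong (_* X) kCk≡[1+k]C[1+k] ⟩
    (suc k C suc k) * X                                           ∎
  where
    open ≡-Reasoning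
    X = #enum (k ∸ k) q 0
    kCk≡[1+k]C[1+k] : k C k ≡ suc k C suc k
    kCk≡[1+k]C[1+k] = trans (sym (+-identityʳ (k C k)))
      (trans (cong (k C k +_) (sym (k>n⇒nCk≡0 {k} {suc k} ≤-refl))) (nCk+nC[k+1]≡[n+1]C[k+1] k k))
... | inj₁ k<n = begin
    #enum (suc n) q (suc k)                                       ≡⟨ #enum-suc n q (suc k) ⟩
    #enum n q (suc k) + (#enum n q k + #withNegative n q (suc k))   ≡⟨ cong₂ _+_ (#enum≡C*#enum n q (suc k) k<n)
                                                                      (cong₂ _+_ (#enum≡C*#enum n q k k≤n) (negative q)) ⟩
    c₁ * A + (c₀ * X + c₁ * B)                                    ≡⟨ cong (λ x → c₁ * A + (c₀ * x + c₁ * B)) X≡A+B ⟩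
    c₁ * A + (c₀ * (A + B) + c₁ * B)                              ≡⟨ solve 4 (λ c₀ c₁ A B → c₁ :* A :+ (c₀ :* (A :+ B) :+ c₁ :* B)
                                                                                    := (c₀ :+ c₁) :* (A :+ B)) refl c₀ c₁ A B ⟩
    (c₀ + c₁) * (A + B)                                           ≡⟨ cong₂ _*_ (nCk+nC[k+1]≡[n+1]C[k+1] n k) (sym X≡A+B) ⟩
    (suc n C suc k) * X                                           ∎
  where
    open ≡-Reasoning
    c₀ = n C k
    c₁ = n C suc k
    A = #enum (n ∸ suc k) q 0
    B = #withNegative (n ∸ suc k) q 0
    X = #enum (n ∸ k) q 0
    X≡A+B : X ≡ A + B
    X≡A+B = trans (cong (λ m → #enum m q 0) (m∸n≡1+m∸[1+n] k<n)) (#enum-suc (n ∸ suc k) q 0)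
    negative : ∀ q → #withNegative n q (suc k) ≡ c₁ * #withNegative (n ∸ suc k) q 0
    negative zero = sym (*-zeroʳ c₁)
    negative (suc q) with 2 + q ≤? n ∸ q ∸ suc k | 2 + q ≤? n ∸ suc k ∸ q
    ... | yes _  | yes _ = #enum≡C*#enum n q (suc k) k<n
    ... | no  _  | no  _ = sym (*-zeroʳ c₁)
    ... | yes h  | no ¬h = contradiction (subst (2 + q ≤_) (m∸n∸o≡m∸o∸n n q (suc k)) h) ¬h
    ... | no  ¬h | yes h = contradiction (subst (2 + q ≤_) (m∸n∸o≡m∸o∸n n (suc k) q) h) ¬h

#negativeOnly : ℕ → ℕ → ℕ
#negativeOnly n q = #enum n q 0

#negativeOnlyAtMost : ℕ → ℕ → ℕ
#negativeOnlyAtMost n r = sumUpTo (#negativeOnly n) (suc r)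

#negativeOnly≡0 : ∀ n q → n ≤ suc q + suc q → #negativeOnly n (suc q) ≡ 0
#negativeOnly≡0 zero    q _ = refl
#negativeOnly≡0 (suc n) q n<2q+2 =
  trans (#enum-suc n (suc q) 0) (cong₂ _+_ (#negativeOnly≡0 n q (≤-trans (n≤1+n n) n<2q+2)) negative)
  where
    negative : #withNegative n (suc q) 0 ≡ 0
    negative with 2 + q ≤? n ∸ q
    ... | no  _ = refl
    ... | yes h = ⊥-elim (<⇒≱ (s≤s (≤-trans (≤-pred n<2q+2) (≤-reflexive (+-suc q q)))) (m≤o∸n⇒m+n≤o (2 + q) q≤n h))
      where
        q≤n : q ≤ n
        q≤n = <⇒≤ (m∸n≢0⇒n<m (λ n∸q≡0 → contradiction (subst (2 + q ≤_) n∸q≡0 h) λ ()))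

#negativeOnlyAtMost-suc : ∀ n r → r + r ≤ n →
  #negativeOnlyAtMost (suc n) r ≡ #negativeOnlyAtMost n r + sumUpTo (#negativeOnly n) r
#negativeOnlyAtMost-suc n r r+r≤n = begin
    sumUpTo (#negativeOnly (suc n)) (suc r)                             ≡⟨ sumUpTo-cong (suc r) (λ q _ → #enum-suc n q 0) ⟩
    sumUpTo (λ q → #negativeOnly n q + #withNegative n q 0) (suc r)      ≡⟨ sumUpTo-distrib-+ (#negativeOnly n) (λ q → #withNegative n q 0) (suc r) ⟩
    #negativeOnlyAtMost n r + sumUpTo (λ q → #withNegative n (suc q) 0) r ≡⟨ cong (#negativeOnlyAtMost n r +_) (sumUpTo-cong r admitted) ⟩
    #negativeOnlyAtMost n r + sumUpTo (#negativeOnly n) r               ∎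
  where
    open ≡-Reasoning
    admitted : ∀ q → q < r → #withNegative n (suc q) 0 ≡ #negativeOnly n q
    admitted q q<r with 2 + q ≤? n ∸ q
    ... | yes _ = refl
    ... | no ¬h = contradiction (m+n≤o⇒m≤o∸n (2 + q)
                    (≤-trans (≤-reflexive (cong suc (sym (+-suc q q)))) (≤-trans (+-mono-≤ q<r q<r) r+r≤n))) ¬h

-- Pascal's rule in n; on the boundary n = 2r + 2 there is no room for r + 1
-- negative pinnacles.
#negativeOnlyAtMost≡C : ∀ n r → suc (r + r) ≤ n → #negativeOnlyAtMost n r ≡ (n ∸ 1) C r
#negativeOnlyAtMost≡C (suc zero)    zero    _ = refl
#negativeOnlyAtMost≡C (suc zero)    (suc r) (s≤s ())
#negativeOnlyAtMost≡C (suc (suc n)) zero    _ =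
  trans (#negativeOnlyAtMost-suc (suc n) 0 z≤n) (trans (+-identityʳ _) (#negativeOnlyAtMost≡C (suc n) 0 (s≤s z≤n)))
#negativeOnlyAtMost≡C (suc (suc n)) (suc r) 2r+3≤n+2 = begin
    #negativeOnlyAtMost (suc (suc n)) (suc r)                        ≡⟨ #negativeOnlyAtMost-suc (suc n) (suc r) 2r+2≤n+1 ⟩
    #negativeOnlyAtMost (suc n) (suc r) + #negativeOnlyAtMost (suc n) r ≡⟨ cong₂ _+_ (upper (#negativeOnlyAtMost≡C (suc n) (suc r))) lower ⟩
    n C suc r + n C r                                                ≡⟨ +-comm (n C suc r) (n C r) ⟩
    n C r + n C suc r                                                ≡⟨ nCk+nC[k+1]≡[n+1]C[k+1] n r ⟩
    suc n C suc r                                                    ∎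
  where
    open ≡-Reasoning
    2r+2≤n+1 : suc r + suc r ≤ suc n
    2r+2≤n+1 = ≤-pred 2r+3≤n+2
    lower : #negativeOnlyAtMost (suc n) r ≡ n C r
    lower = #negativeOnlyAtMost≡C (suc n) r (≤-trans (s≤s (+-monoʳ-≤ r (n≤1+n r))) 2r+2≤n+1)
    boundary : suc r + suc r ≡ suc n → #negativeOnlyAtMost (suc n) (suc r) ≡ n C suc r
    boundary 2r+2≡n+1 = begin
        #negativeOnlyAtMost (suc n) (suc r)                             ≡⟨ sumUpTo-suc (#negativeOnly (suc n)) (suc r) ⟩
        #negativeOnlyAtMost (suc n) r + #negativeOnly (suc n) (suc r)   ≡⟨ cong₂ _+_ lower (#negativeOnly≡0 (suc n) r (≤-reflexive (sym 2r+2≡n+1))) ⟩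
        n C r + 0                                                       ≡⟨ +-identityʳ (n C r) ⟩
        n C r                                                           ≡⟨ nCk≡nC[n∸k] (subst (r ≤_) r+1+r≡n (m≤m+n r (suc r))) ⟩
        n C (n ∸ r)                                                     ≡⟨ cong (n C_) (trans (cong (_∸ r) (sym r+1+r≡n)) (m+n∸m≡n r (suc r))) ⟩
        n C suc r                                                       ∎
      where
        r+1+r≡n : r + suc r ≡ n
        r+1+r≡n = suc-injective 2r+2≡n+1
    upper : (suc (suc r + suc r) ≤ suc n → #negativeOnlyAtMost (suc n) (suc r) ≡ n C suc r) →
            #negativeOnlyAtMost (suc n) (suc r) ≡ n C suc r
    upper below-boundary with suc (suc r + suc r) ≤? suc n
    ... | yes 2r+3≤n+1 = below-boundary 2r+3≤n+1
    ... | no  2r+3≰n+1 = boundary (≤-antisym 2r+2≤n+1 (≮⇒≥ 2r+3≰n+1))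

admissibleWithPositives : (n k : ℕ) → List (SubsetPM n)
admissibleWithPositives n k = concatMap (λ q → enum n q k) (upTo (suc (maxPinnacles n ∸ k)))

admissibleSets : (n : ℕ) → List (SubsetPM n)
admissibleSets n = concatMap (admissibleWithPositives n) (upTo (suc (maxPinnacles n)))

admissibleSets-unique : ∀ n → Unique (admissibleSets n)
admissibleSets-unique n =
  concatMap-unique (λ S → trues (proj₁ S)) (admissibleWithPositives n) (Unique.upTo⁺ (suc (maxPinnacles n)))
    (λ k → concatMap-unique (λ S → trues (proj₂ S)) (λ q → enum n q k) (Unique.upTo⁺ (suc (maxPinnacles n ∸ k))) (λ q → enum-unique n q k)
             (λ q m → proj₁ (proj₂ (enum-sound n q k m))))
    with-positives
  where
    with-positives : ∀ k {S} → S ∈ admissibleWithPositives n k → trues (proj₁ S) ≡ k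
    with-positives k m with q , _ , m′ ← ∈-concatMap-upTo⁻ (λ q → enum n q k) (suc (maxPinnacles n ∸ k)) m = proj₂ (proj₂ (enum-sound n q k m′))

∈-admissibleSets : ∀ n (S : SubsetPM n) → S ∈ admissibleSets n ⇔ AdmissibleSet S
∈-admissibleSets n (P , N) = mk⇔ to from
  where
    m = maxPinnacles n
    to : (P , N) ∈ admissibleSets n → AdmissibleSet (P , N)
    to S∈ with ∈-concatMap-upTo⁻ (admissibleWithPositives n) (suc m) S∈
    ... | k , k<1+m , S∈′ with ∈-concatMap-upTo⁻ (λ q → enum n q k) (suc (m ∸ k)) S∈′
    ...   | q , q<1+m∸k , S∈″ with enum-sound n q k S∈″
    ...     | a , refl , refl = a , ≤-trans (+-monoʳ-≤ k (≤-pred q<1+m∸k)) (≤-reflexive (m+[n∸m]≡n (≤-pred k<1+m)))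
    from : AdmissibleSet (P , N) → (P , N) ∈ admissibleSets n
    from (a , k+q≤m) =
      ∈-concatMap-upTo⁺ (admissibleWithPositives n) (suc m) (s≤s (m+n≤o⇒m≤o (trues P) k+q≤m))
        (∈-concatMap-upTo⁺ (λ q → enum n q (trues P)) (suc (m ∸ trues P))
          (s≤s (m+n≤o⇒m≤o∸n (trues N) (subst (_≤ m) (+-comm (trues P) (trues N)) k+q≤m)))
          (enum-complete P N a))

1+2*maxPinnacles≤n : ∀ n → 1 ≤ n → suc (maxPinnacles n + maxPinnacles n) ≤ n
1+2*maxPinnacles≤n (suc n) _ = s≤s (⌊n/2⌋+⌊n/2⌋≤n n)

1+2k≤n⇒k≤maxPinnacles : ∀ {n k} → suc (k + k) ≤ n → k ≤ maxPinnacles n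
1+2k≤n⇒k≤maxPinnacles {suc n} {k} (s≤s 2k≤n) = ≤-trans (≤-reflexive (n≡⌊n+n/2⌋ k)) (⌊n/2⌋-mono 2k≤n)

length-admissibleSets : ∀ n → 1 ≤ n → length (admissibleSets n) ≡ apsFormula n
length-admissibleSets n 1≤n = begin
    length (admissibleSets n)                                        ≡⟨ length-concatMap-upTo (admissibleWithPositives n) (suc m) ⟩
    sumUpTo (λ k → length (admissibleWithPositives n k)) (suc m)     ≡⟨ sumUpTo-cong (suc m) term ⟩
    sumUpTo term-k (suc m)                                           ≡⟨ sum-map-applyUpTo term-k (λ i → i) (suc m) ⟨
    apsFormula n                                                     ∎
  where
    open ≡-Reasoning
    m = maxPinnacles n
    term-k : ℕ → ℕ
    term-k k = (n C k) * ((n ∸ 1 ∸ k) C (m ∸ k))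
    room : ∀ k → k ≤ m → suc ((m ∸ k) + (m ∸ k)) ≤ n ∸ k
    room k k≤m = m+n≤o⇒m≤o∸n (suc (d + d)) (≤-trans (+-monoʳ-≤ (suc (d + d)) (m≤n+m k k))
                   (≤-trans (≤-reflexive d+d+k+k≡m+m) (1+2*maxPinnacles≤n n 1≤n)))
      where
        d = m ∸ k
        d+d+k+k≡m+m : suc (d + d) + (k + k) ≡ suc (m + m)
        d+d+k+k≡m+m = trans (solve 2 (λ d k → con 1 :+ (d :+ d) :+ (k :+ k) := con 1 :+ ((d :+ k) :+ (d :+ k))) refl d k)
                         (cong (λ x → suc (x + x)) (m∸n+n≡m k≤m))
    term : ∀ k → k < suc m → length (admissibleWithPositives n k) ≡ term-k k
    term k (s≤s k≤m) = begin
        length (admissibleWithPositives n k)                 ≡⟨ length-concatMap-upTo (λ q → enum n q k) (suc (m ∸ k)) ⟩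
        sumUpTo (λ q → #enum n q k) (suc (m ∸ k))            ≡⟨ sumUpTo-cong (suc (m ∸ k)) (λ q _ → #enum≡C*#enum n q k k≤n) ⟩
        sumUpTo (λ q → (n C k) * #negativeOnly (n ∸ k) q) (suc (m ∸ k)) ≡⟨ sumUpTo-distribˡ-* (n C k) (#negativeOnly (n ∸ k)) (suc (m ∸ k)) ⟩
        (n C k) * #negativeOnlyAtMost (n ∸ k) (m ∸ k)        ≡⟨ cong ((n C k) *_) (#negativeOnlyAtMost≡C (n ∸ k) (m ∸ k) (room k k≤m)) ⟩
        (n C k) * ((n ∸ k ∸ 1) C (m ∸ k))                    ≡⟨ cong (λ x → (n C k) * (x C (m ∸ k))) (m∸n∸o≡m∸o∸n n k 1) ⟩
        (n C k) * ((n ∸ 1 ∸ k) C (m ∸ k))                    ∎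
      where
        k≤n : k ≤ n
        k≤n = ≤-trans k≤m (≤-trans (m≤m+n m m) (≤-trans (n≤1+n _) (1+2*maxPinnacles≤n n 1≤n)))

#atMost : (ℕ → ℤ) → ℤ → ℕ → ℕ
#atMost e t L = sumUpTo (λ k → fromBool (does (e k ℤ.≤? t))) L

markedAtMost : (ℕ → ℤ) → (ℕ → Bool) → ℤ → ℕ → ℕ
markedAtMost e marked t k = if marked k then fromBool (does (e k ℤ.≤? t)) else 0

-- position 0 is never a pinnacle, so it is left out
#markedAtMost : (ℕ → ℤ) → (ℕ → Bool) → ℤ → ℕ → ℕ
#markedAtMost e marked t L = sumUpTo (λ k → markedAtMost e marked t (suc k)) (pred L)

leadingDescent : (ℕ → ℤ) → ℤ → ℕ → ℕ
leadingDescent e t (suc (suc L)) = if does (e 0 ℤ.≤? t) ∧ does (e 1 ℤ.<? e 0) then 1 else 0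
leadingDescent e t _             = 0

MarkedArePeaks : ℕ → (ℕ → ℤ) → (ℕ → Bool) → Set
MarkedArePeaks L e marked = ∀ k → suc k < L → marked (suc k) ≡ true →
  suc (suc k) < L × e k ℤ.< e (suc k) × e (suc (suc k)) ℤ.< e (suc k)

-- A leading descent e 0 > e 1 with e 0 ≤ t is held in reserve: should a
-- marked peak be prepended right before it, that peak only brings its left
-- neighbour as a new entry ≤ t.
ScanInvariant : ℕ → (ℕ → ℤ) → (ℕ → Bool) → ℤ → Set
ScanInvariant L e marked t =
    (#atMost e t L ≡ 0 × #markedAtMost e marked t L ≡ 0 × leadingDescent e t L ≡ 0)
  ⊎ suc (#markedAtMost e marked t L + #markedAtMost e marked t L + leadingDescent e t L) ≤ #atMost e t L

MarkedArePeaks-tail : ∀ L e marked → MarkedArePeaks (suc L) e marked →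
  MarkedArePeaks L (λ k → e (suc k)) (λ k → marked (suc k))
MarkedArePeaks-tail L e marked peaks k k+1<L marked-k+2 with peaks (suc k) (s≤s k+1<L) marked-k+2
... | s≤s k+3<L , rising , falling = k+3<L , rising , falling

ScanInvariant-cons : ∀ L e marked t → MarkedArePeaks (suc (suc L)) e marked →
  ScanInvariant (suc L) (λ k → e (suc k)) (λ k → marked (suc k)) t → ScanInvariant (suc (suc L)) e marked t
ScanInvariant-cons L e marked t peaks ih with marked 1 in marked-1
ScanInvariant-cons L e marked t peaks ih | true with peaks 0 (s≤s (s≤s z≤n)) marked-1
ScanInvariant-cons zero e marked t peaks ih | true | s≤s (s≤s ()) , _ , _
ScanInvariant-cons (suc L) e marked t peaks ih | true | _ , e0<e1 , e2<e1 with e 1 ℤ.≤? t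
ScanInvariant-cons (suc L) e marked t peaks ih | true | _ , e0<e1 , e2<e1 | yes e1≤t
  with e 2 ℤ.<? e 1 | e 0 ℤ.≤? t | e 1 ℤ.<? e 0
... | no e2≮e1 | _         | _       = ⊥-elim (e2≮e1 e2<e1)
... | yes _    | no e0≰t   | _       = ⊥-elim (e0≰t (ℤ.≤-trans (ℤ.<⇒≤ e0<e1) e1≤t))
... | yes _    | yes _     | yes e1<e0 = ⊥-elim (ℤ.<-asym e0<e1 e1<e0)
... | yes _    | yes _     | no _ with ih
...   | inj₁ (_ , _ , ())
...   | inj₂ bound = inj₂ (s≤s (≤-trans (≤-reflexive (reserve _)) bound))
  where
    reserve : ∀ x → suc x + suc x + 0 ≡ suc (x + x + 1)
    reserve x = trans (+-identityʳ _) (trans (cong suc (+-suc x x)) (cong suc (sym (+-comm (x + x) 1))))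
ScanInvariant-cons (suc L) e marked t peaks ih | true | _ , e0<e1 , e2<e1 | no e1≰t with e 0 ℤ.≤? t | e 1 ℤ.<? e 0
... | _     | yes e1<e0 = ⊥-elim (ℤ.<-asym e0<e1 e1<e0)
... | yes _ | no _ with ih
...   | inj₁ (none , none′ , _) rewrite none | none′ = inj₂ (s≤s z≤n)
...   | inj₂ bound = inj₂ (≤-trans (m≤n+m _ 1) (s≤s (≤-trans (+-monoʳ-≤ _ z≤n) bound)))
ScanInvariant-cons (suc L) e marked t peaks ih | true | _ , e0<e1 , e2<e1 | no e1≰t | no _ | no _ with ih
...   | inj₁ (none , none′ , _) = inj₁ (none , none′ , refl)
...   | inj₂ bound = inj₂ (≤-trans (s≤s (+-monoʳ-≤ _ z≤n)) bound)
ScanInvariant-cons L e marked t peaks ih | false with e 0 ℤ.≤? t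
... | no _ with ih
...   | inj₁ (none , none′ , _) = inj₁ (none , none′ , refl)
...   | inj₂ bound = inj₂ (≤-trans (s≤s (+-monoʳ-≤ _ z≤n)) bound)
ScanInvariant-cons L e marked t peaks ih | false | yes e0≤t with e 1 ℤ.<? e 0 | e 1 ℤ.≤? t | ih
... | yes e1<e0 | no e1≰t | _ = ⊥-elim (e1≰t (ℤ.≤-trans (ℤ.<⇒≤ e1<e0) e0≤t))
... | yes _     | yes _   | inj₁ (() , _ , _)
... | no _      | _       | inj₁ (_ , none , _) rewrite none = inj₂ (s≤s z≤n)
... | _         | _       | inj₂ bound = inj₂ (s≤s (≤-trans (+-monoʳ-≤ (m + m) (descent≤1 _))
                                          (≤-trans (≤-reflexive (+-comm (m + m) 1)) (≤-trans (s≤s (m≤m+n (m + m) _)) bound))))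
  where
    m = #markedAtMost (λ k → e (suc k)) (λ k → marked (suc k)) t (suc L)
    descent≤1 : ∀ b → (if b then 1 else 0) ≤ 1
    descent≤1 true  = ≤-refl
    descent≤1 false = z≤n

scanInvariant : ∀ L e marked t → MarkedArePeaks L e marked → ScanInvariant L e marked t
scanInvariant zero          e marked t _ = inj₁ (refl , refl , refl)
scanInvariant (suc zero)    e marked t _ with e 0 ℤ.≤? t
... | yes _ = inj₂ (s≤s z≤n)
... | no  _ = inj₁ (refl , refl , refl)
scanInvariant (suc (suc L)) e marked t peaks =
  ScanInvariant-cons L e marked t peaks
    (scanInvariant (suc L) (λ k → e (suc k)) (λ k → marked (suc k)) t (MarkedArePeaks-tail (suc L) e marked peaks))

-- The m marked peaks ≤ t lie strictly above their neighbours, which give at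
-- least m + 1 further entries ≤ t.
1+2*#markedAtMost≤#atMost : ∀ L e marked t → MarkedArePeaks L e marked → 1 ≤ #markedAtMost e marked t L →
  suc (#markedAtMost e marked t L + #markedAtMost e marked t L) ≤ #atMost e t L
1+2*#markedAtMost≤#atMost L e marked t peaks 1≤m with scanInvariant L e marked t peaks
... | inj₁ (_ , none , _) = ⊥-elim (<-irrefl (sym none) 1≤m)
... | inj₂ bound          = ≤-trans (s≤s (m≤m+n _ _)) bound

∑-mono-≤ : ∀ {n} {f g : Fin n → ℕ} → (∀ i → f i ≤ g i) → ∑ f ≤ ∑ g
∑-mono-≤ {zero}  f≤g = z≤n
∑-mono-≤ {suc n} f≤g = +-mono-≤ (f≤g zero) (∑-mono-≤ (λ i → f≤g (suc i)))

f≤∑f : ∀ {n} (f : Fin n → ℕ) i → f i ≤ ∑ f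
f≤∑f f zero    = m≤m+n _ _
f≤∑f f (suc i) = ≤-trans (f≤∑f (λ j → f (suc j)) i) (m≤n+m _ _)

fromBool-does≤1 : ∀ {A : Set} (a? : Dec A) → fromBool (does a?) ≤ 1
fromBool-does≤1 (yes _) = ≤-refl
fromBool-does≤1 (no  _) = z≤n

∑-positions : ∀ {n} (F : ℕ → ℕ) (f : Fin n → ℕ) → (∀ k (k<n : k < n) → F k ≡ f (fromℕ< k<n)) → sumUpTo F n ≡ ∑ f
∑-positions {zero}  F f F≗f = refl
∑-positions {suc n} F f F≗f =
  cong₂ _+_ (F≗f 0 (s≤s z≤n)) (∑-positions (λ k → F (suc k)) (λ i → f (suc i)) (λ k k<n → F≗f (suc k) (s≤s k<n)))

sum-tabulate : ∀ {n} (f : Fin n → ℕ) → sum (tabulate f) ≡ ∑ f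
sum-tabulate {zero}  f = refl
sum-tabulate {suc n} f = cong (f zero +_) (sum-tabulate (λ i → f (suc i)))

∑-trues : ∀ {n} (V : Vec Bool n) → ∑ (λ j → fromBool (lookup V j)) ≡ trues V
∑-trues []      = refl
∑-trues (b ∷ V) = cong (fromBool b +_) (∑-trues V)

∑-frees : ∀ {n} (P N : Vec Bool n) → ∑ (λ j → fromBool (isFree (lookup P j) (lookup N j))) ≡ frees P N
∑-frees []      []      = refl
∑-frees (p ∷ P) (q ∷ N) = cong (fromBool (isFree p q) +_) (∑-frees P N)

allPM : ∀ n → List (PM n)
allPM n = tabulate (false ,_) ++ tabulate (true ,_)

allPM-unique : ∀ n → Unique (allPM n)
allPM-unique n = Unique.++⁺ (Unique.tabulate⁺ (cong proj₂)) (Unique.tabulate⁺ (cong proj₂)) signs-differ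
  where
    signs-differ : ∀ {x} → x ∈ tabulate (false ,_) × x ∈ tabulate (true ,_) → ⊥
    signs-differ (x∈₊ , x∈₋) with ∈-tabulate⁻ {f = false ,_} x∈₊ | ∈-tabulate⁻ {f = true ,_} x∈₋
    ... | _ , refl | _ , ()

∈-allPM : ∀ {n} (x : PM n) → x ∈ allPM n
∈-allPM (false , i) = ∈-++⁺ˡ (∈-tabulate⁺ {f = false ,_} i)
∈-allPM (true  , i) = ∈-++⁺ʳ (tabulate (false ,_)) (∈-tabulate⁺ {f = true ,_} i)

∑± : ∀ {n} → (PM n → ℕ) → ℕ
∑± h = ∑ (λ i → h (false , i)) + ∑ (λ i → h (true , i))

∑±-cong : ∀ {n} {h h′ : PM n → ℕ} → (∀ x → h x ≡ h′ x) → ∑± h ≡ ∑± h′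
∑±-cong h≗h′ = cong₂ _+_ (sum-cong-≗ (λ i → h≗h′ (false , i))) (sum-cong-≗ (λ i → h≗h′ (true , i)))

sum-map-allPM : ∀ {n} (h : PM n → ℕ) → sum (map h (allPM n)) ≡ ∑± h
sum-map-allPM {n} h = begin
    sum (map h (allPM n))                                               ≡⟨ cong sum (map-++ h (tabulate (false ,_)) _) ⟩
    sum (map h (tabulate (false ,_)) ++ map h (tabulate (true ,_)))     ≡⟨ sum-++ (map h (tabulate (false ,_))) _ ⟩
    sum (map h (tabulate (false ,_))) + sum (map h (tabulate (true ,_))) ≡⟨ cong₂ _+_ (cong sum (map-tabulate (false ,_) h)) (cong sum (map-tabulate (true ,_) h)) ⟩
    sum (tabulate (λ i → h (false , i))) + sum (tabulate (λ i → h (true , i))) ≡⟨ cong₂ _+_ (sum-tabulate (λ i → h (false , i))) (sum-tabulate (λ i → h (true , i))) ⟩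
    ∑± h                                                                ∎
  where open ≡-Reasoning

∑±-reindex : ∀ {n} (π : PM n ↔ PM n) (h : PM n → ℕ) → ∑± h ≡ ∑± (λ x → h (Inverse.to π x))
∑±-reindex {n} π h = begin
    ∑± h                                ≡⟨ sum-map-allPM h ⟨
    sum (map h (allPM n))               ≡⟨ sum-↭ (↭-sym (Perm.map⁺ h π[allPM]↭allPM)) ⟩
    sum (map h (map f (allPM n)))       ≡⟨ cong sum (map-∘ (allPM n)) ⟨
    sum (map (λ x → h (f x)) (allPM n)) ≡⟨ sum-map-allPM (λ x → h (f x)) ⟩
    ∑± (λ x → h (f x))                  ∎
  where
    open ≡-Reasoning
    f = Inverse.to π
    π[allPM]↭allPM : map f (allPM n) ↭ allPM n
    π[allPM]↭allPM = ∼bag⇒↭ (unique∧set⇒bag (Unique.map⁺ (Injection.injective (↔⇒↣ π)) (allPM-unique n)) (allPM-unique n)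
      (λ {x} → mk⇔ (λ _ → ∈-allPM x)
                   (λ _ → subst (_∈ map f (allPM n)) (Inverse.strictlyInverseˡ π x) (∈-map⁺ f (∈-allPM (Inverse.from π x))))))

#negativesFrom : ∀ {n} → Vec Bool n → Fin n → ℕ
#negativesFrom N i = ∑ (λ j → if toℕ j <ᵇ toℕ i then 0 else fromBool (lookup N j))

1≤#negativesFrom : ∀ {n} (N : Vec Bool n) i → lookup N i ≡ true → 1 ≤ #negativesFrom N i
1≤#negativesFrom N i Ni = ≤-trans (≤-reflexive (sym term-i)) (f≤∑f (λ j → if toℕ j <ᵇ toℕ i then 0 else fromBool (lookup N j)) i)
  where
    term-i : (if toℕ i <ᵇ toℕ i then 0 else fromBool (lookup N i)) ≡ 1
    term-i with toℕ i <ᵇ toℕ i | <ᵇ-reflects-< (toℕ i) (toℕ i)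
    ... | true  | ofʸ i<i = contradiction i<i (n≮n (toℕ i))
    ... | false | _       = cong fromBool Ni

#freesAbove : ∀ {n} → Vec Bool n → Vec Bool n → Fin n → ℕ
#freesAbove P N i = ∑ (λ j → if toℕ i <ᵇ toℕ j then fromBool (isFree (lookup P j) (lookup N j)) else 0)

PointwiseAdmissible : ∀ {n} → Vec Bool n → Vec Bool n → Set
PointwiseAdmissible P N =
    (∀ i → lookup P i ≡ true → lookup N i ≡ true → ⊥)
  × (∀ i → lookup N i ≡ true → suc (#negativesFrom N i) ≤ #freesAbove P N i)

pointwise⇒admissible : ∀ {n} (P N : Vec Bool n) → PointwiseAdmissible P N → Admissible P N
pointwise⇒admissible []      []      _                   = tt
pointwise⇒admissible (p ∷ P) (q ∷ N) (not-both , room) =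
  head p q refl refl , pointwise⇒admissible P N ((λ i → not-both (suc i)) , (λ i → room (suc i)))
  where
    head : ∀ p′ q′ → p′ ≡ p → q′ ≡ q → AdmissibleAt p′ q′ (trues N) (frees P N)
    head p′    false _    _    = tt
    head true  true  refl refl = not-both zero refl refl
    head false true  refl refl = subst₂ (λ a b → suc (suc a) ≤ b) (∑-trues N) (∑-frees P N) (room zero refl)

-- Necessity

isMember : ∀ {n} → PM n → SubsetPM n → Bool
isMember (false , i) (P , N) = lookup P i
isMember (true  , i) (P , N) = lookup N i

isMember⇒∈± : ∀ {n} (x : PM n) S → isMember x S ≡ true → x ∈± S
isMember⇒∈± (false , i) S x∈S = x∈S
isMember⇒∈± (true  , i) S x∈S = x∈S

-- The one-line notation is read as a sequence indexed by ℕ; positions from n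
-- on carry an arbitrary entry and are never looked at.
module Necessity {n} (w : SignedPerm n) (default : PM n) (S : SubsetPM n) (pinnacles : IsPinnacleSetOf w S) where

  open Inverse (proj₁ w) using (to; from; strictlyInverseˡ; strictlyInverseʳ)

  P = proj₁ S
  N = proj₂ S

  to-injective : ∀ {x y} → to x ≡ to y → x ≡ y
  to-injective {x} {y} eq = trans (sym (strictlyInverseʳ x)) (trans (cong from eq) (strictlyInverseʳ y))

  from-neg : ∀ y → from (neg y) ≡ neg (from y)
  from-neg y = to-injective (trans (strictlyInverseˡ (neg y))
    (trans (cong neg (sym (strictlyInverseˡ y))) (sym (proj₂ w (from y)))))

  member-at-positive-position : ∀ x → isMember x S ≡ true → proj₁ (from x) ≡ false
  member-at-positive-position x x∈S with Equivalence.to (pinnacles x) (isMember⇒∈± x S x∈S)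
  ... | _ , _ , x≡entry , _ = cong proj₁ (trans (cong from x≡entry) (strictlyInverseʳ _))

  negation-of-positive-member : ∀ j → lookup P j ≡ true → proj₁ (from (true , j)) ≡ true
  negation-of-positive-member j +j∈S = begin
      proj₁ (from (true , j))          ≡⟨ cong proj₁ (from-neg (false , j)) ⟩
      not (proj₁ (from (false , j)))   ≡⟨ cong not (member-at-positive-position (false , j) +j∈S) ⟩
      true                             ∎
    where open ≡-Reasoning

  entryAt : ℕ → PM n
  entryAt k with k <? n
  ... | yes k<n = entry w (fromℕ< k<n)
  ... | no  _   = default

  entryAt-< : ∀ k (k<n : k < n) → entryAt k ≡ entry w (fromℕ< k<n)
  entryAt-< k k<n with k <? n
  ... | yes _   = refl
  ... | no  k≮n = contradiction k<n k≮n

  e : ℕ → ℤ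
  e k = val (entryAt k)

  marked : ℕ → Bool
  marked k = isMember (entryAt k) S

  position-injective : ∀ k l (k<n : k < n) (l<n : l < n) → entry w (fromℕ< k<n) ≡ entry w (fromℕ< l<n) → k ≡ l
  position-injective k l k<n l<n eq =
    trans (sym (toℕ-fromℕ< k<n)) (trans (cong (λ x → toℕ (proj₂ x)) (to-injective eq)) (toℕ-fromℕ< l<n))

  marked-are-peaks : MarkedArePeaks n e marked
  marked-are-peaks k k+1<n marked-k+1 with Equivalence.to (pinnacles (entryAt (suc k))) (isMember⇒∈± _ S marked-k+1)
  ... | i , i+2<n , x≡entry , rising , falling
    with position-injective (suc k) (suc i) k+1<n (<-trans (n<1+n (suc i)) i+2<n) (trans (sym (entryAt-< (suc k) k+1<n)) x≡entry)
  ... | refl = i+2<n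
             , subst₂ (λ a b → val a ℤ.< val b) (sym (entryAt-< k (<-trans (n<1+n k) k+1<n))) (sym x≡entry) rising
             , subst₂ (λ a b → val a ℤ.< val b) (sym (entryAt-< (suc (suc k)) i+2<n)) (sym x≡entry) falling

  ¬marked-0 : 0 < n → marked 0 ≡ false
  ¬marked-0 0<n with marked 0 in marked-0
  ... | false = refl
  ... | true with Equivalence.to (pinnacles (entryAt 0)) (isMember⇒∈± _ S marked-0)
  ...   | i , i+2<n , x≡entry , _
    with position-injective 0 (suc i) 0<n (<-trans (n<1+n (suc i)) i+2<n) (trans (sym (entryAt-< 0 0<n)) x≡entry)
  ...     | ()

  ∑-over-entries : ∀ (g : PM n → ℕ) → sumUpTo (λ k → g (entryAt k)) n ≡ ∑± (λ x → if proj₁ (from x) then 0 else g x)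
  ∑-over-entries g = begin
      sumUpTo (λ k → g (entryAt k)) n                           ≡⟨ ∑-positions (λ k → g (entryAt k)) (λ i → g (entry w i)) (λ k k<n → cong g (entryAt-< k k<n)) ⟩
      ∑ (λ i → g (to (false , i)))                              ≡⟨ +-identityʳ _ ⟨
      ∑ (λ i → g (to (false , i))) + 0                          ≡⟨ cong (∑ (λ i → g (to (false , i))) +_) (sum-replicate-zero n) ⟨
      ∑± (λ y → if proj₁ y then 0 else g (to y))                ≡⟨ ∑±-reindex (↔-sym (proj₁ w)) (λ y → if proj₁ y then 0 else g (to y)) ⟩
      ∑± (λ x → if proj₁ (from x) then 0 else g (to (from x)))  ≡⟨ ∑±-cong (λ x → cong (λ z → if proj₁ (from x) then 0 else g z) (strictlyInverseˡ x)) ⟩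
      ∑± (λ x → if proj₁ (from x) then 0 else g x)              ∎
    where open ≡-Reasoning

  #markedAtMost≡∑± : ∀ t → 0 < n → #markedAtMost e marked t n ≡ ∑± (λ x → if isMember x S then fromBool (does (val x ℤ.≤? t)) else 0)
  #markedAtMost≡∑± t 0<n = begin
      #markedAtMost e marked t n                       ≡⟨ lift-position-0 n 0<n (¬marked-0 0<n) ⟨
      sumUpTo (λ k → g (entryAt k)) n                  ≡⟨ ∑-over-entries g ⟩
      ∑± (λ x → if proj₁ (from x) then 0 else g x)     ≡⟨ ∑±-cong members-appear ⟩
      ∑± g                                             ∎
    where
      open ≡-Reasoning
      g : PM n → ℕ
      g x = if isMember x S then fromBool (does (val x ℤ.≤? t)) else 0
      lift-position-0 : ∀ L → 0 < L → marked 0 ≡ false → sumUpTo (markedAtMost e marked t) L ≡ #markedAtMost e marked t L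
      lift-position-0 (suc L) _ ¬m0 rewrite ¬m0 = refl
      members-appear : ∀ x → (if proj₁ (from x) then 0 else g x) ≡ g x
      members-appear x with isMember x S in x∈S
      ... | true rewrite member-at-positive-position x x∈S = refl
      ... | false with proj₁ (from x)
      ...   | true  = refl
      ...   | false = refl

  size-bound : 0 < n → trues P + trues N ≤ maxPinnacles n
  size-bound 0<n = bounded (trues P + trues N) #markedAtMost≡|S|
    where
      t = ℤ.+ n
      val≤n : ∀ (x : PM n) → val x ℤ.≤ t
      val≤n (false , i) = +≤+ (toℕ<n i)
      val≤n (true  , i) = -≤+
      #markedAtMost≡|S| : #markedAtMost e marked t n ≡ trues P + trues N
      #markedAtMost≡|S| = trans (#markedAtMost≡∑± t 0<n) (trans (∑±-cong below-t) (cong₂ _+_ (∑-trues P) (∑-trues N)))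
        where
          below-t : ∀ x → (if isMember x S then fromBool (does (val x ℤ.≤? t)) else 0) ≡ fromBool (isMember x S)
          below-t x with isMember x S
          ... | true  = cong fromBool (dec-true (val x ℤ.≤? t) (val≤n x))
          ... | false = refl
      #atMost≡n : #atMost e t n ≡ n
      #atMost≡n = trans (sumUpTo-cong n (λ k _ → cong fromBool (dec-true (e k ℤ.≤? t) (val≤n (entryAt k))))) (sumUpTo-ones n)
      bounded : ∀ K → #markedAtMost e marked t n ≡ K → K ≤ maxPinnacles n
      bounded zero    _  = z≤n
      bounded (suc K) eq = 1+2k≤n⇒k≤maxPinnacles (subst₂ (λ a b → suc (a + a) ≤ b) eq #atMost≡n
        (1+2*#markedAtMost≤#atMost n e marked t marked-are-peaks (subst (1 ≤_) (sym eq) (s≤s z≤n))))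

  module _ (i : Fin n) where

    private
      t = -[1+ toℕ i ]

    #markedAtMost≡#negativesFrom : 0 < n → #markedAtMost e marked t n ≡ #negativesFrom N i
    #markedAtMost≡#negativesFrom 0<n = trans (#markedAtMost≡∑± t 0<n)
      (cong₂ _+_ (trans (sum-cong-≗ (λ j → positive (lookup P j) j)) (sum-replicate-zero n)) (sum-cong-≗ negative))
      where
        positive : ∀ b j → (if b then fromBool (does (ℤ.+ suc (toℕ j) ℤ.≤? t)) else 0) ≡ 0
        positive true  j = cong fromBool (dec-false (ℤ.+ suc (toℕ j) ℤ.≤? t) λ ())
        positive false j = refl
        negative : ∀ j → (if lookup N j then fromBool (does (-[1+ toℕ j ] ℤ.≤? t)) else 0)
                       ≡ (if toℕ j <ᵇ toℕ i then 0 else fromBool (lookup N j))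
        negative j with lookup N j | toℕ j <ᵇ toℕ i | <ᵇ-reflects-< (toℕ j) (toℕ i)
        ... | false | true  | _       = refl
        ... | false | false | _       = refl
        ... | true  | true  | ofʸ j<i = cong fromBool (dec-false (-[1+ toℕ j ] ℤ.≤? t) λ { (-≤- i≤j) → <⇒≱ j<i i≤j })
        ... | true  | false | ofⁿ j≮i = cong fromBool (dec-true (-[1+ toℕ j ] ℤ.≤? t) (-≤- (≮⇒≥ j≮i)))

    -- The entries ≤ -(i+1) of the one-line word are negative pinnacles up to
    -- -(i+1) or negatives of free absolute values above i+1.
    #atMost≤#negativesFrom+#freesAbove : lookup N i ≡ true → #atMost e t n ≤ #negativesFrom N i + #freesAbove P N i
    #atMost≤#negativesFrom+#freesAbove −i∈S = begin
        #atMost e t n                                      ≡⟨ ∑-over-entries (λ x → fromBool (does (val x ℤ.≤? t))) ⟩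
        ∑ (λ j → appears (false , j)) + ∑ (λ j → appears (true , j))
          ≤⟨ +-mono-≤ (≤-trans (∑-mono-≤ positive) (≤-reflexive (sum-replicate-zero n))) (∑-mono-≤ negative) ⟩
        0 + ∑ (λ j → Q j + F j)                            ≡⟨ ∑-distrib-+ Q F ⟩
        #negativesFrom N i + #freesAbove P N i              ∎
      where
        open ≤-Reasoning
        appears : PM n → ℕ
        appears x = if proj₁ (from x) then 0 else fromBool (does (val x ℤ.≤? t))
        Q F : Fin n → ℕ
        Q j = if toℕ j <ᵇ toℕ i then 0 else fromBool (lookup N j)
        F j = if toℕ i <ᵇ toℕ j then fromBool (isFree (lookup P j) (lookup N j)) else 0
        positive : ∀ j → appears (false , j) ≤ 0
        positive j with proj₁ (from (false , j))
        ... | true  = z≤n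
        ... | false = ≤-reflexive (cong fromBool (dec-false (ℤ.+ suc (toℕ j) ℤ.≤? t) λ ()))
        negative : ∀ j → appears (true , j) ≤ Q j + F j
        negative j with proj₁ (from (true , j)) in −j-sign
        ... | true  = z≤n
        ... | false with toℕ j <ᵇ toℕ i | <ᵇ-reflects-< (toℕ j) (toℕ i)
        ...   | true  | ofʸ j<i = ≤-trans (≤-reflexive (cong fromBool (dec-false (-[1+ toℕ j ] ℤ.≤? t) λ { (-≤- i≤j) → <⇒≱ j<i i≤j }))) z≤n
        ...   | false | ofⁿ j≮i with lookup N j in −j∈S
        ...     | true  = ≤-trans (fromBool-does≤1 (-[1+ toℕ j ] ℤ.≤? t)) (s≤s z≤n)
        ...     | false with lookup P j in +j∈S
        ...       | true  = ⊥-elim (true≢false (trans (sym (negation-of-positive-member j +j∈S)) −j-sign))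
        ...       | false with toℕ i <ᵇ toℕ j | <ᵇ-reflects-< (toℕ i) (toℕ j)
        ...         | true  | _       = fromBool-does≤1 (-[1+ toℕ j ] ℤ.≤? t)
        ...         | false | ofⁿ i≮j = ⊥-elim (true≢false (trans (sym −i∈S) (subst (λ k → lookup N k ≡ false) i≡j −j∈S)))
          where
            i≡j : j ≡ i
            i≡j = toℕ-injective (≤-antisym (≮⇒≥ i≮j) (≮⇒≥ j≮i))

    room-below : 0 < n → lookup N i ≡ true → suc (#negativesFrom N i) ≤ #freesAbove P N i
    room-below 0<n −i∈S = +-cancelˡ-≤ Q _ _ (begin
        Q + suc Q                     ≡⟨ +-suc Q Q ⟩
        suc (Q + Q)                   ≤⟨ subst (λ m → suc (m + m) ≤ #atMost e t n) (#markedAtMost≡#negativesFrom 0<n) peaks-bound ⟩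
        #atMost e t n                 ≤⟨ #atMost≤#negativesFrom+#freesAbove −i∈S ⟩
        Q + #freesAbove P N i         ∎)
      where
        open ≤-Reasoning
        Q = #negativesFrom N i
        peaks-bound : suc (#markedAtMost e marked t n + #markedAtMost e marked t n) ≤ #atMost e t n
        peaks-bound = 1+2*#markedAtMost≤#atMost n e marked t marked-are-peaks
          (subst (1 ≤_) (sym (#markedAtMost≡#negativesFrom 0<n)) (1≤#negativesFrom N i −i∈S))

  pointwise-admissible : 0 < n → PointwiseAdmissible P N
  pointwise-admissible 0<n =
      (λ i +i∈S −i∈S → true≢false (trans (sym (negation-of-positive-member i +i∈S)) (member-at-positive-position (true , i) −i∈S)))
    , (λ i → room-below i 0<n)

necessity : ∀ {n} → 0 < n → (S : SubsetPM n) → InAPSB S → AdmissibleSet S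
necessity {suc _} 0<n S (w , pinnacles) =
  pointwise⇒admissible (proj₁ S) (proj₂ S) (pointwise-admissible 0<n) , size-bound 0<n
  where open Necessity w (false , zero) S pinnacles

interleave : ∀ {A : Set} → List A → List A → List A
interleave (l ∷ ls) (s ∷ ss) = l ∷ s ∷ interleave ls ss
interleave ls       []       = ls
interleave []       (s ∷ ss) = s ∷ ss

module _ {A : Set} (_≺_ : A → A → Set) where

  data PeakAt : List A → A → Set where
    here  : ∀ {a b c rest} → a ≺ b → c ≺ b → PeakAt (a ∷ b ∷ c ∷ rest) b
    there : ∀ {a xs x} → PeakAt xs x → PeakAt (a ∷ xs) x

  Ascending : List A → Set
  Ascending []           = ⊤
  Ascending (x ∷ [])     = ⊤
  Ascending (x ∷ y ∷ ys) = x ≺ y × Ascending (y ∷ ys)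

  -- In interleave ls ss each peak s sits between valleys l and l′; only l′ ≺ s is
  -- required, since ascending valleys give l ≺ l′.
  Interlaces : List A → List A → Set
  Interlaces []            []       = ⊤
  Interlaces []            (s ∷ ss) = ⊥
  Interlaces (l ∷ ls)      []       = ⊤
  Interlaces (l ∷ [])      (s ∷ ss) = ⊥
  Interlaces (l ∷ l′ ∷ ls) (s ∷ ss) = l′ ≺ s × Interlaces (l′ ∷ ls) ss

module _ {A B : Set} {_≺_ : A → A → Set} {_≺′_ : B → B → Set} (f : A → B) (f-mono : ∀ {x y} → x ≺ y → f x ≺′ f y) where

  Ascending-map : ∀ xs → Ascending _≺_ xs → Ascending _≺′_ (map f xs)
  Ascending-map []           _        = tt
  Ascending-map (x ∷ [])     _        = tt
  Ascending-map (x ∷ y ∷ ys) (x≺y , a) = f-mono x≺y , Ascending-map (y ∷ ys) a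

  Interlaces-map : ∀ ls ss → Interlaces _≺_ ls ss → Interlaces _≺′_ (map f ls) (map f ss)
  Interlaces-map []            []       _          = tt
  Interlaces-map (l ∷ ls)      []       _          = tt
  Interlaces-map (l ∷ l′ ∷ ls) (s ∷ ss) (l′≺s , i) = f-mono l′≺s , Interlaces-map (l′ ∷ ls) ss i

module _ {A : Set} {_≺_ : A → A → Set} (≺-trans : ∀ {x y z} → x ≺ y → y ≺ z → x ≺ z)
         (≺-asym : ∀ {x y} → x ≺ y → y ≺ x → ⊥) where

  Ascending⇒¬PeakAt : ∀ xs {x} → Ascending _≺_ xs → PeakAt _≺_ xs x → ⊥
  Ascending⇒¬PeakAt (a ∷ b ∷ c ∷ rest) (_ , b≺c , _) (here _ c≺b) = ≺-asym b≺c c≺b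
  Ascending⇒¬PeakAt (a ∷ [])     _       (there ())
  Ascending⇒¬PeakAt (a ∷ y ∷ ys) (_ , asc) (there p) = Ascending⇒¬PeakAt (y ∷ ys) asc p

  PeakAt-interleave⁻ : ∀ ls ss {x} → Interlaces _≺_ ls ss → Ascending _≺_ ls → PeakAt _≺_ (interleave ls ss) x → x ∈ ss
  PeakAt-interleave⁻ (l ∷ ls) [] _ asc p = ⊥-elim (Ascending⇒¬PeakAt (l ∷ ls) asc p)
  PeakAt-interleave⁻ (l ∷ l′ ∷ ls) (s ∷ [])      _          _         (here _ _) = here refl
  PeakAt-interleave⁻ (l ∷ l′ ∷ ls) (s ∷ s′ ∷ ss) _          _         (here _ _) = here refl
  PeakAt-interleave⁻ (l ∷ l′ ∷ ls) (s ∷ [])      (l′≺s , _) (_ , asc) (there (here s≺l′ _)) = ⊥-elim (≺-asym s≺l′ l′≺s)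
  PeakAt-interleave⁻ (l ∷ l′ ∷ ls) (s ∷ [])      _          (_ , asc) (there (there p)) = ⊥-elim (Ascending⇒¬PeakAt (l′ ∷ ls) asc p)
  PeakAt-interleave⁻ (l ∷ l′ ∷ ls) (s ∷ s′ ∷ ss) (l′≺s , _) _         (there (here s≺l′ _)) = ⊥-elim (≺-asym s≺l′ l′≺s)
  PeakAt-interleave⁻ (l ∷ l′ ∷ ls) (s ∷ s′ ∷ ss) (_ , i)    (_ , asc) (there (there p)) = there (PeakAt-interleave⁻ (l′ ∷ ls) (s′ ∷ ss) i asc p)

  PeakAt-interleave⁺ : ∀ ls ss {x} → Interlaces _≺_ ls ss → Ascending _≺_ ls → x ∈ ss → PeakAt _≺_ (interleave ls ss) x
  PeakAt-interleave⁺ (l ∷ l′ ∷ ls) (s ∷ [])      (l′≺s , _) (l≺l′ , _)   (here refl) = here (≺-trans l≺l′ l′≺s) l′≺s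
  PeakAt-interleave⁺ (l ∷ l′ ∷ ls) (s ∷ s′ ∷ ss) (l′≺s , _) (l≺l′ , _)   (here refl) = here (≺-trans l≺l′ l′≺s) l′≺s
  PeakAt-interleave⁺ (l ∷ l′ ∷ ls) (s ∷ ss)      (_ , i)    (_ , asc) (there x∈ss) = there (there (PeakAt-interleave⁺ (l′ ∷ ls) ss i asc x∈ss))

  Interlaces-snocValley : ∀ ls ss x → Interlaces _≺_ ls ss → Interlaces _≺_ (ls ++ x ∷ []) ss
  Interlaces-snocValley []            []       x _          = tt
  Interlaces-snocValley (l ∷ ls)      []       x _          = tt
  Interlaces-snocValley (l ∷ l′ ∷ ls) (s ∷ ss) x (l′≺s , i) = l′≺s , Interlaces-snocValley (l′ ∷ ls) ss x i

  Interlaces-snocPeak : ∀ ls ss x → Interlaces _≺_ ls ss → 2 + length ss ≤ length ls → All (_≺ x) ls →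
    Interlaces _≺_ ls (ss ++ x ∷ [])
  Interlaces-snocPeak (l ∷ [])      []       x _          (s≤s ())  _
  Interlaces-snocPeak (l ∷ l′ ∷ ls) []       x _          _         (_ ∷ l′≺x ∷ _) = l′≺x , tt
  Interlaces-snocPeak (l ∷ l′ ∷ ls) (s ∷ ss) x (l′≺s , i) (s≤s room) (_ ∷ below)  = l′≺s , Interlaces-snocPeak (l′ ∷ ls) ss x i room below

  Interlaces-++Peaks : ∀ ls ss ts → Interlaces _≺_ ls ss → 1 + (length ss + length ts) ≤ length ls →
    All (λ t → All (_≺ t) ls) ts → Interlaces _≺_ ls (ss ++ ts)
  Interlaces-++Peaks ls ss []       i _    _ rewrite ++-identityʳ ss = i
  Interlaces-++Peaks ls ss (t ∷ ts) i room (below ∷ belows) =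
    subst (Interlaces _≺_ ls) (++-assoc ss (t ∷ []) ts)
      (Interlaces-++Peaks ls (ss ++ t ∷ []) ts
        (Interlaces-snocPeak ls ss t i (≤-trans (s≤s (≤-trans (≤-reflexive (+-comm 1 (length ss))) (+-monoʳ-≤ (length ss) (s≤s z≤n)))) room) below)
        (subst (λ m → suc m ≤ length ls) length-shift room) belows)
    where
      length-shift : length ss + suc (length ts) ≡ length (ss ++ t ∷ []) + length ts
      length-shift = trans (+-suc (length ss) (length ts))
                       (cong (_+ length ts) (trans (+-comm 1 (length ss)) (sym (length-++ ss))))

  Ascending-snoc : ∀ ls x → Ascending _≺_ ls → All (_≺ x) ls → Ascending _≺_ (ls ++ x ∷ [])
  Ascending-snoc []            x _             _             = tt
  Ascending-snoc (l ∷ [])      x _             (l≺x ∷ _)     = l≺x , tt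
  Ascending-snoc (l ∷ l′ ∷ ls) x (l≺l′ , asc) (_ ∷ below)    = l≺l′ , Ascending-snoc (l′ ∷ ls) x asc below

interleave-↭ : ∀ {A : Set} (ls ss : List A) → interleave ls ss ↭ ls ++ ss
interleave-↭ (l ∷ ls) (s ∷ ss) = ↭-prep l (↭-trans (↭-prep s (interleave-↭ ls ss)) (↭-sym (shift s ls ss)))
interleave-↭ (l ∷ ls) []       = ↭-sym (Perm.++-identityʳ (l ∷ ls))
interleave-↭ []       []       = ↭-refl
interleave-↭ []       (s ∷ ss) = ↭-refl

injective⇒surjective : ∀ {n} (f : Fin n → Fin n) → (∀ {i j} → f i ≡ f j → i ≡ j) → ∀ y → ∃ λ x → f x ≡ y
injective⇒surjective {suc n} f f-injective y with any? (λ x → f x Fin.≟ y)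
... | yes hit = hit
... | no  miss = ⊥-elim (<-irrefl refl (injective⇒≤ {f = avoid} avoid-injective))
  where
    y≢f : ∀ x → y ≢ f x
    y≢f x y≡fx = miss (x , sym y≡fx)
    avoid : Fin (suc n) → Fin n
    avoid x = punchOut (y≢f x)
    avoid-injective : ∀ {x x′} → avoid x ≡ avoid x′ → x ≡ x′
    avoid-injective eq = f-injective (punchOut-injective (y≢f _) (y≢f _) eq)

flipIf : ∀ {n} → Bool → PM n → PM n
flipIf false x = x
flipIf true  x = neg x

module FromOneLine {n} (v : Fin n → PM n) (v-injective : ∀ {i j} → proj₂ (v i) ≡ proj₂ (v j) → i ≡ j) where

  private
    position : Fin n → Fin n
    position a = proj₁ (injective⇒surjective (λ i → proj₂ (v i)) v-injective a)

    at-position : ∀ a → proj₂ (v (position a)) ≡ a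
    at-position a = proj₂ (injective⇒surjective (λ i → proj₂ (v i)) v-injective a)

    to : PM n → PM n
    to (s , i) = flipIf s (v i)

    from : PM n → PM n
    from (b , a) = (proj₁ (v (position a)) xor b , position a)

    to∘from : ∀ y → to (from y) ≡ y
    to∘from (b , a) = flip-back (v (position a)) (at-position a) b
      where
        flip-back : ∀ (x : PM n) → proj₂ x ≡ a → ∀ b → flipIf (proj₁ x xor b) x ≡ (b , a)
        flip-back (false , _) refl false = refl
        flip-back (false , _) refl true  = refl
        flip-back (true  , _) refl false = refl
        flip-back (true  , _) refl true  = refl

    from∘to : ∀ x → from (to x) ≡ x
    from∘to (false , i) = sign-back (position (proj₂ (v i))) (v-injective (at-position (proj₂ (v i))))
      where
        sign-back : ∀ j → j ≡ i → (proj₁ (v j) xor proj₁ (v i) , j) ≡ (false , i)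
        sign-back j refl with proj₁ (v j)
        ... | false = refl
        ... | true  = refl
    from∘to (true  , i) = sign-back (position (proj₂ (v i))) (v-injective (at-position (proj₂ (v i))))
      where
        sign-back : ∀ j → j ≡ i → (proj₁ (v j) xor not (proj₁ (v i)) , j) ≡ (true , i)
        sign-back j refl with proj₁ (v j)
        ... | false = refl
        ... | true  = refl

    to-odd : ∀ x → to (neg x) ≡ neg (to x)
    to-odd (false , i) = refl
    to-odd (true  , i) = cong (_, proj₂ (v i)) (sym (not-involutive (proj₁ (v i))))

  signedPerm : SignedPerm n
  signedPerm = mk↔ₛ′ to from to∘from from∘to , to-odd

lookupOr : ∀ {A : Set} → A → List A → ℕ → A
lookupOr d []       k       = d
lookupOr d (x ∷ xs) zero    = x
lookupOr d (x ∷ xs) (suc k) = lookupOr d xs k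

lookupOr-∈ : ∀ {A : Set} (d : A) xs k → k < length xs → lookupOr d xs k ∈ xs
lookupOr-∈ d (x ∷ xs) zero    _         = here refl
lookupOr-∈ d (x ∷ xs) (suc k) (s≤s k<n) = there (lookupOr-∈ d xs k k<n)

lookupOr-injective : ∀ {A B : Set} (f : A → B) (d : A) xs {k l} → Unique (map f xs) → k < length xs → l < length xs →
  f (lookupOr d xs k) ≡ f (lookupOr d xs l) → k ≡ l
lookupOr-injective f d (x ∷ xs) {zero}  {zero}  _          _         _         _  = refl
lookupOr-injective f d (x ∷ xs) {zero}  {suc l} (x∉ ∷ _)   _         (s≤s l<n) eq = ⊥-elim (All.lookup x∉ (∈-map⁺ f (lookupOr-∈ d xs l l<n)) eq)
lookupOr-injective f d (x ∷ xs) {suc k} {zero}  (x∉ ∷ _)   (s≤s k<n) _         eq = ⊥-elim (All.lookup x∉ (∈-map⁺ f (lookupOr-∈ d xs k k<n)) (sym eq))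
lookupOr-injective f d (x ∷ xs) {suc k} {suc l} (_ ∷ xs!)  (s≤s k<n) (s≤s l<n) eq = cong suc (lookupOr-injective f d xs xs! k<n l<n eq)

module _ {A : Set} {_≺_ : A → A → Set} (d : A) where

  PeakAt⇒index : ∀ xs {x} → PeakAt _≺_ xs x → ∃ λ i → 2 + i < length xs × x ≡ lookupOr d xs (suc i)
    × lookupOr d xs i ≺ lookupOr d xs (suc i) × lookupOr d xs (suc (suc i)) ≺ lookupOr d xs (suc i)
  PeakAt⇒index (a ∷ b ∷ c ∷ rest) (here a≺b c≺b) = 0 , s≤s (s≤s (s≤s z≤n)) , refl , a≺b , c≺b
  PeakAt⇒index (a ∷ xs) (there p) with PeakAt⇒index xs p
  ... | i , i+2<n , x≡ , rising , falling = suc i , s≤s i+2<n , x≡ , rising , falling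

  index⇒PeakAt : ∀ xs {x} i → 2 + i < length xs → x ≡ lookupOr d xs (suc i) →
    lookupOr d xs i ≺ lookupOr d xs (suc i) → lookupOr d xs (suc (suc i)) ≺ lookupOr d xs (suc i) → PeakAt _≺_ xs x
  index⇒PeakAt (a ∷ b ∷ c ∷ rest) zero    _             refl rising falling = here rising falling
  index⇒PeakAt (a ∷ b ∷ [])       zero    (s≤s (s≤s ())) _   _      _
  index⇒PeakAt (a ∷ xs)           (suc i) (s≤s i+2<n)   x≡   rising falling = there (index⇒PeakAt xs i i+2<n x≡ rising falling)

_≺_ : ∀ {n} → PM n → PM n → Set
x ≺ y = val x ℤ.< val y

≺-trans : ∀ {n} {x y z : PM n} → x ≺ y → y ≺ z → x ≺ z
≺-trans = ℤ.<-trans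

≺-asym : ∀ {n} {x y : PM n} → x ≺ y → y ≺ x → ⊥
≺-asym = ℤ.<-asym

module FromList {n} (xs : List (PM n)) (default : PM n) (length≡n : length xs ≡ n) (absolute-unique : Unique (map proj₂ xs)) where

  oneLine : Fin n → PM n
  oneLine i = lookupOr default xs (toℕ i)

  oneLine-injective : ∀ {i j} → proj₂ (oneLine i) ≡ proj₂ (oneLine j) → i ≡ j
  oneLine-injective {i} {j} eq = toℕ-injective (lookupOr-injective proj₂ default xs absolute-unique (in-range i) (in-range j) eq)
    where
      in-range : ∀ (i : Fin n) → toℕ i < length xs
      in-range i = subst (toℕ i <_) (sym length≡n) (toℕ<n i)

  open FromOneLine oneLine oneLine-injective public using (signedPerm)

  IsPinnacle⇔PeakAt : ∀ x → IsPinnacle signedPerm x ⇔ PeakAt _≺_ xs x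
  IsPinnacle⇔PeakAt x = mk⇔ pinnacle⇒peak peak⇒pinnacle
    where
      at : ℕ → PM n
      at k = lookupOr default xs k
      pinnacle⇒peak : IsPinnacle signedPerm x → PeakAt _≺_ xs x
      pinnacle⇒peak (i , i+2<n , x≡ , rising , falling) =
        index⇒PeakAt default xs i (subst (2 + i <_) (sym length≡n) i+2<n)
          (trans x≡ (cong at (toℕ-fromℕ< _)))
          (subst₂ (λ a b → at a ≺ at b) (toℕ-fromℕ< _) (toℕ-fromℕ< _) rising)
          (subst₂ (λ a b → at a ≺ at b) (toℕ-fromℕ< i+2<n) (toℕ-fromℕ< _) falling)
      peak⇒pinnacle : PeakAt _≺_ xs x → IsPinnacle signedPerm x
      peak⇒pinnacle peak with PeakAt⇒index default xs peak
      ... | i , i+2<len , x≡ , rising , falling =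
        i , i+2<n ,
        trans x≡ (cong at (sym (toℕ-fromℕ< _))) ,
        subst₂ (λ a b → at a ≺ at b) (sym (toℕ-fromℕ< _)) (sym (toℕ-fromℕ< _)) rising ,
        subst₂ (λ a b → at a ≺ at b) (sym (toℕ-fromℕ< i+2<n)) (sym (toℕ-fromℕ< _)) falling
        where
          i+2<n : 2 + i < n
          i+2<n = subst (2 + i <_) length≡n i+2<len

-- Sufficiency

liftPM : ∀ {n} → PM n → PM (suc n)
liftPM (b , i) = (b , suc i)

liftPM-mono : ∀ {n} {x y : PM n} → x ≺ y → liftPM x ≺ liftPM y
liftPM-mono {x = false , _} {false , _} (+<+ i<j) = +<+ (s≤s i<j)
liftPM-mono {x = true  , _} {false , _} -<+       = -<+
liftPM-mono {x = true  , _} {true  , _} (-<- j<i) = -<- (s≤s j<i)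

optional : ∀ {A : Set} → Bool → A → List A
optional true  a = a ∷ []
optional false a = []

length-optional : ∀ {A : Set} b (a : A) → length (optional b a) ≡ fromBool b
length-optional true  a = refl
length-optional false a = refl

∈-optional : ∀ {A : Set} b {a x : A} → x ∈ optional b a → b ≡ true × x ≡ a
∈-optional true (here x≡a) = refl , x≡a

All-optional : ∀ {A : Set} {Q : A → Set} b {a} → Q a → All Q (optional b a)
All-optional true  q = q ∷ []
All-optional false q = []

negativesOf : ∀ {n} → Vec Bool n → List (PM n)
negativesOf []      = []
negativesOf (b ∷ V) = map liftPM (negativesOf V) ++ optional b (true , zero)

positivesOf : ∀ {n} → Vec Bool n → List (PM n)
positivesOf []      = []
positivesOf (b ∷ V) = optional b (false , zero) ++ map liftPM (positivesOf V)

length-negativesOf : ∀ {n} (V : Vec Bool n) → length (negativesOf V) ≡ trues V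
length-negativesOf []      = refl
length-negativesOf (b ∷ V) = trans (length-++ (map liftPM (negativesOf V)))
  (trans (cong₂ _+_ (trans (length-map liftPM (negativesOf V)) (length-negativesOf V)) (length-optional b _)) (+-comm (trues V) _))

length-positivesOf : ∀ {n} (V : Vec Bool n) → length (positivesOf V) ≡ trues V
length-positivesOf []      = refl
length-positivesOf (b ∷ V) = trans (length-++ (optional b _))
  (cong₂ _+_ (length-optional b _) (trans (length-map liftPM (positivesOf V)) (length-positivesOf V)))

IsNegative IsPositive : ∀ {n} → PM n → Set
IsNegative x = proj₁ x ≡ true
IsPositive x = proj₁ x ≡ false

negativesOf-negative : ∀ {n} (V : Vec Bool n) → All IsNegative (negativesOf V)
negativesOf-negative []      = []
negativesOf-negative (b ∷ V) = All.++⁺ (All.map⁺ (negativesOf-negative V)) (All-optional b refl)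

positivesOf-positive : ∀ {n} (V : Vec Bool n) → All IsPositive (positivesOf V)
positivesOf-positive []      = []
positivesOf-positive (b ∷ V) = All.++⁺ (All-optional b refl) (All.map⁺ (positivesOf-positive V))

negative≺positive : ∀ {n} {x y : PM n} → IsNegative x → IsPositive y → x ≺ y
negative≺positive {x = true , _} {false , _} refl refl = -<+

lifted≺-1 : ∀ {n} (xs : List (PM n)) → All IsNegative xs → All (_≺ (true , zero)) (map liftPM xs)
lifted≺-1 []             []        = []
lifted≺-1 ((true , _) ∷ xs) (refl ∷ negs) = -<- (s≤s z≤n) ∷ lifted≺-1 xs negs

negativesOf-ascending : ∀ {n} (V : Vec Bool n) → Ascending _≺_ (negativesOf V)
negativesOf-ascending [] = tt
negativesOf-ascending (true ∷ V) =
  Ascending-snoc ≺-trans ≺-asym (map liftPM (negativesOf V)) _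
    (Ascending-map liftPM liftPM-mono (negativesOf V) (negativesOf-ascending V)) (lifted≺-1 (negativesOf V) (negativesOf-negative V))
negativesOf-ascending (false ∷ V) rewrite ++-identityʳ (map liftPM (negativesOf V)) =
  Ascending-map liftPM liftPM-mono (negativesOf V) (negativesOf-ascending V)

freeNegatives : ∀ {n} → Vec Bool n → Vec Bool n → List (PM n)
freeNegatives P N = negativesOf (zipWith isFree P N)

freeNegatives-interlace : ∀ {n} (P N : Vec Bool n) → Admissible P N → Interlaces _≺_ (freeNegatives P N) (negativesOf N)
freeNegatives-interlace []          []          _ = tt
freeNegatives-interlace (false ∷ P) (false ∷ N) (_ , a) rewrite ++-identityʳ (map liftPM (negativesOf N)) =
  Interlaces-snocValley ≺-trans ≺-asym (map liftPM (freeNegatives P N)) (map liftPM (negativesOf N)) (true , zero)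
    (Interlaces-map liftPM liftPM-mono _ _ (freeNegatives-interlace P N a))
freeNegatives-interlace (true ∷ P)  (false ∷ N) (_ , a)
  rewrite ++-identityʳ (map liftPM (negativesOf N)) | ++-identityʳ (map liftPM (freeNegatives P N)) =
  Interlaces-map liftPM liftPM-mono _ _ (freeNegatives-interlace P N a)
freeNegatives-interlace (false ∷ P) (true ∷ N)  (room , a) rewrite ++-identityʳ (map liftPM (freeNegatives P N)) =
  Interlaces-snocPeak ≺-trans ≺-asym (map liftPM (freeNegatives P N)) (map liftPM (negativesOf N)) (true , zero)
    (Interlaces-map liftPM liftPM-mono _ _ (freeNegatives-interlace P N a))
    (subst₂ (λ a b → 2 + a ≤ b)
      (sym (trans (length-map liftPM (negativesOf N)) (length-negativesOf N)))
      (sym (trans (length-map liftPM (freeNegatives P N)) (length-negativesOf (zipWith isFree P N)))) room)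
    (lifted≺-1 (freeNegatives P N) (negativesOf-negative (zipWith isFree P N)))

∈-negativesOf : ∀ {n} (V : Vec Bool n) {x} → x ∈ negativesOf V ⇔ (IsNegative x × lookup V (proj₂ x) ≡ true)
∈-negativesOf V = mk⇔ (to V) (from V)
  where
    to : ∀ {n} (V : Vec Bool n) {x} → x ∈ negativesOf V → IsNegative x × lookup V (proj₂ x) ≡ true
    to (b ∷ V) x∈ with ∈-++⁻ (map liftPM (negativesOf V)) x∈
    ... | inj₁ x∈′ with ∈-map⁻ liftPM x∈′
    ...   | _ , y∈ , refl = to V y∈
    to (b ∷ V) x∈ | inj₂ x∈′ with ∈-optional b x∈′
    ...   | refl , refl = refl , refl
    from : ∀ {n} (V : Vec Bool n) {x} → IsNegative x × lookup V (proj₂ x) ≡ true → x ∈ negativesOf V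
    from (b ∷ V) {true , zero}  (refl , refl) = ∈-++⁺ʳ (map liftPM (negativesOf V)) (here refl)
    from (b ∷ V) {true , suc j} (refl , Vj)   = ∈-++⁺ˡ (∈-map⁺ liftPM (from V (refl , Vj)))

∈-positivesOf : ∀ {n} (V : Vec Bool n) {x} → x ∈ positivesOf V ⇔ (IsPositive x × lookup V (proj₂ x) ≡ true)
∈-positivesOf V = mk⇔ (to V) (from V)
  where
    to : ∀ {n} (V : Vec Bool n) {x} → x ∈ positivesOf V → IsPositive x × lookup V (proj₂ x) ≡ true
    to (b ∷ V) x∈ with ∈-++⁻ (optional b (false , zero)) x∈
    ... | inj₂ x∈′ with ∈-map⁻ liftPM x∈′
    ...   | _ , y∈ , refl = to V y∈
    to (b ∷ V) x∈ | inj₁ x∈′ with ∈-optional b x∈′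
    ...   | refl , refl = refl , refl
    from : ∀ {n} (V : Vec Bool n) {x} → IsPositive x × lookup V (proj₂ x) ≡ true → x ∈ positivesOf V
    from (b ∷ V) {false , zero}  (refl , refl) = here refl
    from (b ∷ V) {false , suc j} (refl , Vj)   = ∈-++⁺ʳ (optional b (false , zero)) (∈-map⁺ liftPM (from V (refl , Vj)))

∈-pinnacles : ∀ {n} (P N : Vec Bool n) x → x ∈ negativesOf N ++ positivesOf P ⇔ x ∈± (P , N)
∈-pinnacles P N x = mk⇔ (to x) (from x)
  where
    to : ∀ x → x ∈ negativesOf N ++ positivesOf P → x ∈± (P , N)
    to x x∈ with ∈-++⁻ (negativesOf N) x∈
    ... | inj₁ x∈N with Equivalence.to (∈-negativesOf N) x∈N
    ...   | refl , Nj = Nj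
    to x x∈ | inj₂ x∈P with Equivalence.to (∈-positivesOf P) x∈P
    ...   | refl , Pj = Pj
    from : ∀ x → x ∈± (P , N) → x ∈ negativesOf N ++ positivesOf P
    from (true  , j) x∈S = ∈-++⁺ˡ (Equivalence.from (∈-negativesOf N) (refl , x∈S))
    from (false , j) x∈S = ∈-++⁺ʳ (negativesOf N) (Equivalence.from (∈-positivesOf P) (refl , x∈S))

entries : ∀ {n} → Vec Bool n → Vec Bool n → List (PM n)
entries P N = freeNegatives P N ++ (negativesOf N ++ positivesOf P)

private
  insert-first : ∀ {A : Set} (X Y Z : List A) x → (X ++ x ∷ []) ++ ((Y ++ []) ++ ([] ++ Z)) ↭ x ∷ X ++ Y ++ Z
  insert-first X Y Z x rewrite ++-identityʳ Y | ++-assoc X (x ∷ []) (Y ++ Z) = shift x X (Y ++ Z)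

  insert-second : ∀ {A : Set} (X Y Z : List A) x → (X ++ []) ++ ((Y ++ x ∷ []) ++ ([] ++ Z)) ↭ x ∷ X ++ Y ++ Z
  insert-second X Y Z x rewrite ++-identityʳ X | ++-assoc Y (x ∷ []) Z = ↭-trans (++⁺ˡ X (shift x Y Z)) (shift x X (Y ++ Z))

  insert-third : ∀ {A : Set} (X Y Z : List A) x → (X ++ []) ++ ((Y ++ []) ++ (x ∷ Z)) ↭ x ∷ X ++ Y ++ Z
  insert-third X Y Z x rewrite ++-identityʳ X | ++-identityʳ Y = ↭-trans (++⁺ˡ X (shift x Y Z)) (shift x X (Y ++ Z))

entries-∷ : ∀ {n} p q (P N : Vec Bool n) → AdmissibleAt p q (trues N) (frees P N) →
  ∃ λ b → entries (p ∷ P) (q ∷ N) ↭ (b , zero) ∷ map liftPM (entries P N)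
entries-∷ p q P N head rewrite map-++ liftPM (freeNegatives P N) (negativesOf N ++ positivesOf P)
                             | map-++ liftPM (negativesOf N) (positivesOf P) = by-heads p q head
  where
    X = map liftPM (freeNegatives P N)
    Y = map liftPM (negativesOf N)
    Z = map liftPM (positivesOf P)
    by-heads : ∀ p q → AdmissibleAt p q (trues N) (frees P N) → ∃ λ b → entries (p ∷ P) (q ∷ N) ↭ (b , zero) ∷ X ++ Y ++ Z
    by-heads false false _ = true  , insert-first X Y Z (true , zero)
    by-heads false true  _ = true  , insert-second X Y Z (true , zero)
    by-heads true  false _ = false , insert-third X Y Z (false , zero)
    by-heads true  true  ()

absoluteValues-entries : ∀ {n} (P N : Vec Bool n) → Admissible P N → map proj₂ (entries P N) ↭ allFin n
absoluteValues-entries []      []      _          = ↭-refl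
absoluteValues-entries {suc n} (p ∷ P) (q ∷ N) (head , a) with entries-∷ p q P N head
... | b , entries↭ = begin
    map proj₂ (entries (p ∷ P) (q ∷ N))            ↭⟨ map⁺ proj₂ entries↭ ⟩
    zero ∷ map proj₂ (map liftPM (entries P N))     ≡⟨ cong (zero ∷_) (trans (sym (map-∘ (entries P N))) (map-∘ (entries P N))) ⟩
    zero ∷ map suc (map proj₂ (entries P N))        ↭⟨ ↭-prep zero (map⁺ suc (absoluteValues-entries P N a)) ⟩
    zero ∷ map suc (allFin n)                       ≡⟨ cong (zero ∷_) (map-tabulate (λ i → i) suc) ⟩
    allFin (suc n)                                  ∎
  where open PermutationReasoning

sufficiency : ∀ {n} → 0 < n → (S : SubsetPM n) → AdmissibleSet S → InAPSB S
sufficiency {n@(suc _)} 0<n (P , N) (a , few) = signedPerm , pinnacle-set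
  where
    valleys = freeNegatives P N
    peaks = negativesOf N ++ positivesOf P
    word = interleave valleys peaks

    absoluteValues : map proj₂ word ↭ allFin n
    absoluteValues = ↭-trans (map⁺ proj₂ (interleave-↭ valleys peaks)) (absoluteValues-entries P N a)

    length-word : length word ≡ n
    length-word = trans (sym (length-map proj₂ word)) (trans (Perm.↭-length absoluteValues) (length-tabulate (λ i → i)))

    open FromList word (false , zero) length-word (Unique-resp-↭ (↭-sym absoluteValues) (Unique.allFin⁺ n))

    more-valleys : 1 + (length (negativesOf N) + length (positivesOf P)) ≤ length valleys
    more-valleys = subst₂ (λ k f → 1 + k ≤ f)
      (sym (cong₂ _+_ (length-negativesOf N) (length-positivesOf P))) (sym (length-negativesOf (zipWith isFree P N)))
      (+-cancelˡ-≤ K _ _ (≤-trans (≤-reflexive (+-suc K K))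
        (≤-trans (s≤s (+-mono-≤ K≤m K≤m)) (≤-trans (1+2*maxPinnacles≤n n 0<n) (≤-reflexive (sym K+F≡n))))))
      where
        K = trues N + trues P
        K≤m : K ≤ maxPinnacles n
        K≤m = subst (_≤ maxPinnacles n) (+-comm (trues P) (trues N)) few
        K+F≡n : K + frees P N ≡ n
        K+F≡n = trans (+-assoc (trues N) (trues P) _) (trues+trues+frees≡n P N a)

    interlaces : Interlaces _≺_ valleys peaks
    interlaces = Interlaces-++Peaks ≺-trans ≺-asym valleys (negativesOf N) (positivesOf P) (freeNegatives-interlace P N a) more-valleys
      (All.map (λ post → All.map (λ neg → negative≺positive neg post) (negativesOf-negative (zipWith isFree P N))) (positivesOf-positive P))

    ascending : Ascending _≺_ valleys
    ascending = negativesOf-ascending (zipWith isFree P N)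

    pinnacle-set : IsPinnacleSetOf signedPerm (P , N)
    pinnacle-set x = mk⇔
      (λ x∈S → Equivalence.from (IsPinnacle⇔PeakAt x)
                 (PeakAt-interleave⁺ ≺-trans ≺-asym valleys peaks interlaces ascending (Equivalence.from (∈-pinnacles P N x) x∈S)))
      (λ pinnacle → Equivalence.to (∈-pinnacles P N x)
                 (PeakAt-interleave⁻ ≺-trans ≺-asym valleys peaks interlaces ascending (Equivalence.to (IsPinnacle⇔PeakAt x) pinnacle)))

AdmissibleSet⇔InAPSB : ∀ {n} → 0 < n → (S : SubsetPM n) → AdmissibleSet S ⇔ InAPSB S
AdmissibleSet⇔InAPSB 0<n S = mk⇔ (sufficiency 0<n S) (necessity 0<n S)

theorem3p12 : (n : ℕ) → 2 ≤ n →
    Σ (List (SubsetPM n)) λ L →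
      Unique L × ((S : SubsetPM n) → (S ∈ L) ⇔ InAPSB S) × (length L ≡ apsFormula n)
theorem3p12 n 2≤n =
    admissibleSets n
  , admissibleSets-unique n
  , (λ S → AdmissibleSet⇔InAPSB 0<n S ⇔-∘ ∈-admissibleSets n S)
  , length-admissibleSets n 0<n
  where
    0<n : 0 < n
    0<n = ≤-trans (s≤s z≤n) 2≤n
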